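{- Let $1\le k_1<\cdots<k_s$ be integers with $k_s\ge 2$, and let $r=\lfloor\log_2(k_s)\rfloor+1$. Then $\Phi_{2^r}(x-1)$ divides $P_{k_1,\dots,k_s}(x)$, the characteristic polynomial of the minimal homogeneous linear recurrence with integer coefficients satisfied by the sequence $\{S_n\}_{n\in\mathbb{N}}$, where $$S_n=\sum_{j=0}^n(-1)^{\binom{j}{k_1}+\cdots+\binom{j}{k_s}}\binom{n}{j}.$$
   Context: $\mathbb{N}=\{1,2,3,\dots\}$. $S_n$ is the exponential sum of the symmetric Boolean function $\sigma_{n,k_1}+\cdots+\sigma_{n,k_s}$, where $\sigma_{n,k}$ is the elementary symmetric polynomial of degree $k$ in $n$ variables over $\mathbb{F}_2$. $\Phi_m$ is the $m$-th cyclotomic polynomial. A homogeneous linear recurrence $x_n=\sum_{i=1}^D a_ix_{n-i}$ with $a_i\in\mathbb{Z}$ has characteristic polynomial $x^D-\sum_{i=1}^D a_ix^{D-i}$; "minimal" means of least order. -}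

module Defs where

open import Data.Nat as ℕ using (ℕ; zero; suc; _∸_; _≤_; _<_)
open import Data.Nat.Combinatorics using (_C_)
open import Data.Nat.Logarithm using (⌊log₂_⌋)
open import Data.Integer as ℤ using (ℤ; +_; -_; -1ℤ; 0ℤ; 1ℤ)
open import Data.Nat.ListAction using (sum)
open import Data.List using (List; []; _∷_; [_]; map; upTo; reverse; length; foldr)
open import Data.Product using (∃)
open import Relation.Binary.PropositionalEquality using (_≡_)

sumℤ : List ℤ → ℤ
sumℤ = foldr ℤ._+_ 0ℤ

binSum : List ℕ → ℕ → ℕ
binSum ks j = sum (map (λ k → j C k) ks)

S : List ℕ → ℕ → ℤ
S ks n = sumℤ (map (λ j → (-1ℤ ℤ.^ binSum ks j) ℤ.* (+ (n C j))) (upTo (suc n)))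

-- Homogeneous linear recurrences x_n = a₁ x_{n-1} + ⋯ + a_D x_{n-D}
-- A recurrence is given by the list  as = a₁ ∷ a₂ ∷ ⋯ ∷ a_D ∷ []  (D = length as).

recSum : List ℤ → (ℕ → ℤ) → ℕ → ℤ
recSum []       x n = 0ℤ
recSum (a ∷ as) x n = a ℤ.* x (n ∸ 1) ℤ.+ recSum as x (n ∸ 1)

-- The sequence {x_n}_{n ∈ ℕ}, ℕ = {1,2,3,…}, satisfies the recurrence:
-- x_n = Σ a_i x_{n-i} whenever all indices n, n-1, …, n-D lie in {1,2,…},
-- i.e. for every n ≥ D + 1.
Satisfies : (ℕ → ℤ) → List ℤ → Set
Satisfies x as = ∀ n → length as < n → x n ≡ recSum as x n

MinimalRecurrence : (ℕ → ℤ) → List ℤ → Set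
MinimalRecurrence x as =
  Satisfies x as × (∀ bs → Satisfies x bs → length as ≤ length bs)
  where open import Data.Product using (_×_)

-- Polynomials over ℤ as coefficient lists, lowest degree first.

Poly : Set
Poly = List ℤ

coeff : Poly → ℕ → ℤ
coeff []       _       = 0ℤ
coeff (c ∷ p)  zero    = c
coeff (c ∷ p)  (suc m) = coeff p m

infixl 6 _+ₚ_
infixl 7 _*ₚ_ _·ₚ_

_+ₚ_ : Poly → Poly → Poly
[]      +ₚ q       = q
(c ∷ p) +ₚ []      = c ∷ p
(c ∷ p) +ₚ (d ∷ q) = (c ℤ.+ d) ∷ (p +ₚ q)

_·ₚ_ : ℤ → Poly → Poly
c ·ₚ p = map (c ℤ.*_) p

_*ₚ_ : Poly → Poly → Poly
[]      *ₚ q = []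
(c ∷ p) *ₚ q = (c ·ₚ q) +ₚ (0ℤ ∷ (p *ₚ q))

_∘ₚ_ : Poly → Poly → Poly
[]      ∘ₚ q = []
(c ∷ p) ∘ₚ q = [ c ] +ₚ (q *ₚ (p ∘ₚ q))

_∣ₚ_ : Poly → Poly → Set
a ∣ₚ b = ∃ λ q → ∀ m → coeff b m ≡ coeff (a *ₚ q) m

xMinus1 : Poly
xMinus1 = -1ℤ ∷ 1ℤ ∷ []

-- Characteristic polynomial  x^D - Σ_{i=1}^{D} a_i x^{D-i}
-- of the recurrence given by as = a₁ ∷ ⋯ ∷ a_D; its coefficient list
-- (lowest degree first) is  -a_D, …, -a₁, 1.
charPoly : List ℤ → Poly
charPoly as = reverse (1ℤ ∷ map -_ as)

-- Cyclotomic polynomial Φ_{2^r} for r ≥ 1:  Φ_{2^r}(x) = x^{2^{r-1}} + 1.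
-- (Only 2-power indices are needed.)
Φ2^ : ℕ → Poly
Φ2^ zero    = -1ℤ ∷ 1ℤ ∷ []
Φ2^ (suc r) = 1ℤ ∷ (pad (2 ℕ.^ r ∸ 1))
  where
  pad : ℕ → Poly
  pad zero    = 1ℤ ∷ []
  pad (suc k) = 0ℤ ∷ pad k

rOf : ℕ → ℕ
rOf k = ⌊log₂ k ⌋ ℕ.+ 1

-- Write ε j = (−1)^(C(j,k₁)+⋯+C(j,kₛ)), so that S is the binomial transform of ε, and let
-- M = 2^(r−1). Since (x − 1)^(2^a) ≡ x^(2^a) + 1 (mod 2), shifting j by 2^a changes the exponent
-- of ε, modulo 2, by its 2^a-th finite difference, a sum of binomial coefficients C(j, kᵢ − 2^a).
-- Every kᵢ is below 2M, so ε has period 2M, while at j = k − M for the least kᵢ = k ≥ M the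
-- exponent jumps by an odd amount. Hence u j = ε (M + j) − ε j is M-antiperiodic and nonzero, and
-- V = (E − 1)^M S − S, the binomial transform of u (E the shift), is annihilated by
-- G(x) = Φ_{2^r}(x − 1) = 1 + (x − 1)^M without vanishing from index 1 on. G is monic of degree M
-- and Eisenstein at 2. Reduce the characteristic polynomial P of a recurrence satisfied by S
-- modulo G; the remainder R also annihilates V. If R ≠ 0, its lowest coefficient not divisible by 2
-- forces, through the recurrence given by G, every term of V to be even, and then (dividing by 2)
-- divisible by every power of 2, so V = 0. Hence R = 0 and G ∣ P.
module Submission where

open import Defs
open import Data.Nat using (ℕ; _≤_; _<_)
open import Data.Integer using (ℤ)
open import Data.List using (List; _++_; [_])
open import Data.List.Relation.Unary.All using (All)
open import Data.List.Relation.Unary.Linked using (Linked)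

open import Data.Empty using (⊥-elim)
open import Data.Integer as ℤ using (+_; -_; -1ℤ; 0ℤ; 1ℤ; _+_; _*_; _-_)
open import Data.Integer.Divisibility.Signed
  using (_∣_; divides; quotient; ∣-refl; _∣?_; ∣ᵤ⇒∣; ∣⇒∣ᵤ; ∣m∣n⇒∣m+n; ∣m∣n⇒∣m-n; ∣m⇒∣-m; ∣n⇒∣m*n; ∣m⇒∣m*n; *-cancelʳ-∣)
import Data.Integer.Properties as ℤP
open import Algebra.Properties.CommutativeSemigroup ℤP.+-commutativeSemigroup
  using () renaming (interchange to +-interchange; x∙yz≈y∙xz to x∙yz≈y∙xz⁺)
open import Algebra.Properties.CommutativeSemigroup ℤP.*-commutativeSemigroup
  using (x∙yz≈y∙xz) renaming (interchange to *-interchange)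
open import Data.Integer.Tactic.RingSolver using (solve-∀)
open import Data.List using ([]; _∷_; map; length; reverse; applyUpTo)
import Data.List.Properties as LP
import Data.List.Relation.Unary.All as All
open import Data.List.Relation.Unary.All using ([]; _∷_)
import Data.List.Relation.Unary.AllPairs as AllPairs
import Data.List.Relation.Unary.Any as Any
open import Data.List.Relation.Unary.Any using (Any; here)
open import Data.List.Relation.Unary.Any.Properties using (++⁺ʳ)
import Data.List.Relation.Unary.Linked as Linked
open import Data.List.Relation.Unary.Linked using (_∷_)
open import Data.List.Relation.Unary.Linked.Properties using (Linked⇒AllPairs)
open import Data.Nat as ℕ using (zero; suc; _∸_; z≤n; s≤s; _≤?_; _<?_; ⌊_/2⌋)
open import Data.Nat.Combinatorics using (_C_; k>n⇒nCk≡0; nCk+nC[k+1]≡[n+1]C[k+1]; nCn≡1)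
import Data.Nat.Divisibility as ℕ∣
open import Data.Nat.Logarithm using (⌊log₂_⌋; ⌊log₂⌋-mono-≤; ⌊log₂⌊n/2⌋⌋≡⌊log₂n⌋∸1; ⌊log₂[2^n]⌋≡n)
open import Data.Nat.Primality using (Prime; euclidsLemma; prime[2]; prime⇒nonTrivial; prime⇒nonZero)
import Data.Nat.Properties as ℕP
open import Data.Nat.Tactic.RingSolver using () renaming (solve-∀ to ℕ-solve-∀)
open import Data.Product using (∃-syntax; _×_; _,_; proj₁; proj₂)
open import Data.Sum using (_⊎_; inj₁; inj₂; [_,_]′)
open import Function using (_∘_)
open import Relation.Binary.PropositionalEquality
  using (_≡_; _≢_; refl; sym; trans; cong; cong₂; subst; module ≡-Reasoning)
open import Relation.Nullary using (¬_; yes; no)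
open import Relation.Unary using (Decidable)
open ≡-Reasoning

-- Finite sums and divisibility

∑< : ℕ → (ℕ → ℤ) → ℤ
∑< zero    f = 0ℤ
∑< (suc n) f = f 0 + ∑< n (f ∘ suc)

syntax ∑< n (λ i → e) = ∑[ i < n ] e

∑-cong : ∀ n {f g : ℕ → ℤ} → (∀ i → i < n → f i ≡ g i) → ∑< n f ≡ ∑< n g
∑-cong zero    f≡g = refl
∑-cong (suc n) f≡g = cong₂ _+_ (f≡g 0 (s≤s z≤n)) (∑-cong n (λ i i<n → f≡g (suc i) (s≤s i<n)))

∑-zero : ∀ n {f : ℕ → ℤ} → (∀ i → i < n → f i ≡ 0ℤ) → ∑< n f ≡ 0ℤ
∑-zero zero    f≡0 = refl
∑-zero (suc n) f≡0 =
  cong₂ _+_ (f≡0 0 (s≤s z≤n)) (∑-zero n (λ i i<n → f≡0 (suc i) (s≤s i<n)))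

∑-distrib-+ : ∀ n (f g : ℕ → ℤ) → ∑[ i < n ] (f i + g i) ≡ ∑< n f + ∑< n g
∑-distrib-+ zero    f g = refl
∑-distrib-+ (suc n) f g = trans (cong (_+_ (f 0 + g 0)) (∑-distrib-+ n (f ∘ suc) (g ∘ suc)))
  (+-interchange (f 0) (g 0) _ _)

∑-distrib-- : ∀ n (f g : ℕ → ℤ) → ∑[ i < n ] (f i - g i) ≡ ∑< n f - ∑< n g
∑-distrib-- zero    f g = refl
∑-distrib-- (suc n) f g = begin
  (f 0 - g 0) + ∑[ i < n ] (f (suc i) - g (suc i))   ≡⟨ cong (_+_ (f 0 - g 0)) (∑-distrib-- n (f ∘ suc) (g ∘ suc)) ⟩
  (f 0 - g 0) + (∑< n (f ∘ suc) - ∑< n (g ∘ suc))    ≡⟨ +-interchange (f 0) (- g 0) _ _ ⟩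
  (f 0 + ∑< n (f ∘ suc)) + (- g 0 - ∑< n (g ∘ suc)) ≡⟨ cong (_+_ (∑< (suc n) f)) (sym (ℤP.neg-distrib-+ (g 0) _)) ⟩
  ∑< (suc n) f - ∑< (suc n) g                        ∎

∑-*ʳ : ∀ n (f : ℕ → ℤ) c → ∑[ i < n ] (f i * c) ≡ ∑< n f * c
∑-*ʳ zero    f c = sym (ℤP.*-zeroˡ c)
∑-*ʳ (suc n) f c =
  trans (cong (_+_ (f 0 * c)) (∑-*ʳ n (f ∘ suc) c)) (sym (ℤP.*-distribʳ-+ c (f 0) _))

∑-split : ∀ m n (f : ℕ → ℤ) → ∑< (m ℕ.+ n) f ≡ ∑< m f + ∑[ i < n ] f (m ℕ.+ i)
∑-split zero    n f = sym (ℤP.+-identityˡ _)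
∑-split (suc m) n f = trans (cong (_+_ (f 0)) (∑-split m n (f ∘ suc))) (sym (ℤP.+-assoc (f 0) _ _))

∑-last : ∀ n (f : ℕ → ℤ) → ∑< (suc n) f ≡ ∑< n f + f n
∑-last zero    f = ℤP.+-comm (f 0) 0ℤ
∑-last (suc n) f = trans (cong (_+_ (f 0)) (∑-last n (f ∘ suc))) (sym (ℤP.+-assoc (f 0) _ _))

∣-∑ : ∀ {d} n {f : ℕ → ℤ} → (∀ i → i < n → d ∣ f i) → d ∣ ∑< n f
∣-∑ {d} zero    d∣f = divides 0ℤ (sym (ℤP.*-zeroˡ d))
∣-∑     (suc n) d∣f = ∣m∣n⇒∣m+n (d∣f 0 (s≤s z≤n)) (∣-∑ n (λ i i<n → d∣f (suc i) (s≤s i<n)))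

∣-*-∣ : ∀ {a b x y} → a ∣ x → b ∣ y → a * b ∣ x * y
∣-*-∣ {a} {b} (divides s refl) (divides t refl) = divides (s * t) (*-interchange s a t b)

prime∣*⇒∣⊎∣ : ∀ {p} → Prime p → ∀ {x y} → + p ∣ x * y → + p ∣ x ⊎ + p ∣ y
prime∣*⇒∣⊎∣ {p} p-prime {x} {y} p∣xy
  with euclidsLemma ℤ.∣ x ∣ ℤ.∣ y ∣ p-prime (subst (p ℕ∣.∣_) (ℤP.abs-* x y) (∣⇒∣ᵤ p∣xy))
... | inj₁ p∣x = inj₁ (∣ᵤ⇒∣ p∣x)
... | inj₂ p∣y = inj₂ (∣ᵤ⇒∣ p∣y)

n<m^n : ∀ {m} → 1 < m → ∀ n → n < m ℕ.^ n
n<m^n 1<m zero    = s≤s z≤n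
n<m^n {m} 1<m (suc n) = ℕP.≤-trans (ℕP.+-mono-≤ (ℕP.≤-trans (s≤s z≤n) ih) ih)
  (ℕP.≤-trans (ℕP.≤-reflexive (cong (m ℕ.^ n ℕ.+_) (sym (ℕP.+-identityʳ _)))) (ℕP.*-monoˡ-≤ (m ℕ.^ n) 1<m))
  where ih = n<m^n 1<m n

powers∣⇒≡0 : ∀ {p} → 1 < p → ∀ {z} → (∀ K → + (p ℕ.^ K) ∣ z) → z ≡ 0ℤ
powers∣⇒≡0 {p} 1<p {z} p^K∣z with ℤ.∣ z ∣ ℕ.≟ 0
... | yes ∣z∣≡0 = ℤP.∣i∣≡0⇒i≡0 ∣z∣≡0
... | no  ∣z∣≢0 = ⊥-elim (ℕP.<⇒≱ (n<m^n 1<p ℤ.∣ z ∣)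
                    (ℕ∣.∣⇒≤ {{ℕ.≢-nonZero ∣z∣≢0}} (∣⇒∣ᵤ (p^K∣z ℤ.∣ z ∣))))

least-failure : ∀ {P : ℕ → Set} → Decidable P → ∀ n →
  (∀ i → i < n → P i) ⊎ ∃[ k ] (k < n × (∀ i → i < k → P i) × ¬ P k)
least-failure P? zero = inj₁ (λ i ())
least-failure P? (suc n) with least-failure P? n
... | inj₂ (k , k<n , below , ¬Pk) = inj₂ (k , ℕP.m<n⇒m<1+n k<n , below , ¬Pk)
... | inj₁ below with P? n
...   | no  ¬Pn = inj₂ (n , ℕP.n<1+n n , below , ¬Pn)
...   | yes Pn  = inj₁ (λ i i<1+n → [ below i , (λ { refl → Pn }) ]′ (ℕP.m<1+n⇒m<n∨m≡n i<1+n))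

-- Finite differences and the binomial transform

Δ : (ℕ → ℤ) → ℕ → ℤ
Δ X n = X (suc n) - X n

Δ^ : ℕ → (ℕ → ℤ) → ℕ → ℤ
Δ^ zero    X = X
Δ^ (suc k) X = Δ (Δ^ k X)

Δ^-local : ∀ k {X Y : ℕ → ℤ} n → (∀ m → n ≤ m → m ≤ n ℕ.+ k → X m ≡ Y m) → Δ^ k X n ≡ Δ^ k Y n
Δ^-local zero    n X≡Y = X≡Y n ℕP.≤-refl (ℕP.m≤m+n n 0)
Δ^-local (suc k) n X≡Y = cong₂ _-_
  (Δ^-local k (suc n) (λ m n<m m≤n+k → X≡Y m (ℕP.<⇒≤ n<m) (ℕP.≤-trans m≤n+k (ℕP.≤-reflexive (sym (ℕP.+-suc n k))))))
  (Δ^-local k n (λ m n≤m m≤n+k → X≡Y m n≤m (ℕP.≤-trans m≤n+k (ℕP.+-monoʳ-≤ n (ℕP.n≤1+n k)))))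

Δ^-cong : ∀ k {X Y : ℕ → ℤ} n → (∀ m → X m ≡ Y m) → Δ^ k X n ≡ Δ^ k Y n
Δ^-cong k n X≡Y = Δ^-local k n (λ m _ _ → X≡Y m)

Δ^-zero : ∀ k n → Δ^ k (λ _ → 0ℤ) n ≡ 0ℤ
Δ^-zero zero    n = refl
Δ^-zero (suc k) n = cong₂ _-_ (Δ^-zero k (suc n)) (Δ^-zero k n)

Δ^-top : ∀ k {X : ℕ → ℤ} n → (∀ m → n ≤ m → m < n ℕ.+ k → X m ≡ 0ℤ) → Δ^ k X n ≡ X (n ℕ.+ k)
Δ^-top zero    {X} n X≡0 = cong X (sym (ℕP.+-identityʳ n))
Δ^-top (suc k) {X} n X≡0 = begin
  Δ^ k X (suc n) - Δ^ k X n ≡⟨ cong₂ _-_ (Δ^-top k (suc n) (λ m n<m m<n+k → X≡0 m (ℕP.<⇒≤ n<m) (ℕP.<-≤-trans m<n+k n+k≤)))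
                                        (trans (Δ^-local k n (λ m n≤m m≤n+k → X≡0 m n≤m (ℕP.≤-trans (s≤s m≤n+k) n+k≤))) (Δ^-zero k n)) ⟩
  X (suc n ℕ.+ k) - 0ℤ      ≡⟨ ℤP.+-identityʳ _ ⟩
  X (suc n ℕ.+ k)           ≡⟨ cong X (sym (ℕP.+-suc n k)) ⟩
  X (n ℕ.+ suc k)           ∎
  where
  n+k≤ : suc n ℕ.+ k ≤ n ℕ.+ suc k
  n+k≤ = ℕP.≤-reflexive (sym (ℕP.+-suc n k))

Δ^-+ : ∀ k (X Y : ℕ → ℤ) n → Δ^ k (λ m → X m + Y m) n ≡ Δ^ k X n + Δ^ k Y n
Δ^-+ zero    X Y n = refl
Δ^-+ (suc k) X Y n = trans (cong₂ _-_ (Δ^-+ k X Y (suc n)) (Δ^-+ k X Y n))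
  (lemma (Δ^ k X (suc n)) (Δ^ k Y (suc n)) (Δ^ k X n) (Δ^ k Y n))
  where
  lemma : ∀ (a b c d : ℤ) → (a + b) - (c + d) ≡ (a - c) + (b - d)
  lemma = solve-∀

Δ^-* : ∀ k c (X : ℕ → ℤ) n → Δ^ k (λ m → c * X m) n ≡ c * Δ^ k X n
Δ^-* zero    c X n = refl
Δ^-* (suc k) c X n = trans (cong₂ _-_ (Δ^-* k c X (suc n)) (Δ^-* k c X n)) (lemma c _ _)
  where
  lemma : ∀ (c a b : ℤ) → c * a - c * b ≡ c * (a - b)
  lemma = solve-∀

Δ^-compose : ∀ k l (X : ℕ → ℤ) n → Δ^ (k ℕ.+ l) X n ≡ Δ^ k (Δ^ l X) n
Δ^-compose zero    l X n = refl
Δ^-compose (suc k) l X n = cong₂ _-_ (Δ^-compose k l X (suc n)) (Δ^-compose k l X n)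

Δ^-suc : ∀ k (X : ℕ → ℤ) n → Δ^ (suc k) X n ≡ Δ^ k (Δ X) n
Δ^-suc k X n = trans (cong (λ j → Δ^ j X n) (ℕP.+-comm 1 k)) (Δ^-compose k 1 X n)

-- (x - 1)^(2^a) ≡ x^(2^a) + 1 modulo 2.
frobenius-Δ^ : ∀ a (X : ℕ → ℤ) n → + 2 ∣ Δ^ (2 ℕ.^ a) X n - X (n ℕ.+ 2 ℕ.^ a) - X n
frobenius-Δ^ zero    X n rewrite ℕP.+-comm n 1 = divides (- X n) (lemma (X (suc n)) (X n))
  where
  lemma : ∀ (y x : ℤ) → (y - x) - y - x ≡ - x * + 2
  lemma = solve-∀
frobenius-Δ^ (suc a) X n = subst (+ 2 ∣_) (sym (trans (cong₂ (λ A P → A - P - X n) compose shift)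
    (lemma (Δ^ m Y n) (Y (n ℕ.+ m)) (Y n) (X (n ℕ.+ m ℕ.+ m)) (X (n ℕ.+ m)) (X n))))
  (∣m∣n⇒∣m+n (∣m∣n⇒∣m+n (∣m∣n⇒∣m+n (frobenius-Δ^ a Y n) (frobenius-Δ^ a X (n ℕ.+ m))) (frobenius-Δ^ a X n))
             (divides (X (n ℕ.+ m)) refl))
  where
  m = 2 ℕ.^ a
  Y = Δ^ m X
  m+m : 2 ℕ.^ suc a ≡ m ℕ.+ m
  m+m = cong (m ℕ.+_) (ℕP.+-identityʳ m)
  compose : Δ^ (2 ℕ.^ suc a) X n ≡ Δ^ m Y n
  compose = trans (cong (λ j → Δ^ j X n) m+m) (Δ^-compose m m X n)
  shift : X (n ℕ.+ 2 ℕ.^ suc a) ≡ X (n ℕ.+ m ℕ.+ m)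
  shift = cong X (trans (cong (n ℕ.+_) m+m) (sym (ℕP.+-assoc n m m)))
  lemma : ∀ (A B C P Q R : ℤ) → A - P - R ≡ ((A - B - C) + (B - P - Q)) + (C - Q - R) + Q * + 2
  lemma = solve-∀

frobenius-difference : ∀ a (X : ℕ → ℤ) n → + 2 ∣ (X (n ℕ.+ 2 ℕ.^ a) - X n) - Δ^ (2 ℕ.^ a) X n
frobenius-difference a X n = subst (+ 2 ∣_) (lemma (Δ^ (2 ℕ.^ a) X n) (X (n ℕ.+ 2 ℕ.^ a)) (X n))
  (∣m∣n⇒∣m+n (∣m⇒∣-m (frobenius-Δ^ a X n)) (divides (- X n) refl))
  where
  lemma : ∀ d x y → - (d - x - y) + - y * + 2 ≡ (x - y) - d
  lemma = solve-∀

δ : ℕ → ℕ → ℤ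
δ zero    zero    = 1ℤ
δ zero    (suc m) = 0ℤ
δ (suc i) zero    = 0ℤ
δ (suc i) (suc m) = δ i m

δ-< : ∀ {i m} → m < i → δ i m ≡ 0ℤ
δ-< {suc i} {zero}  _         = refl
δ-< {suc i} {suc m} (s≤s m<i) = δ-< m<i

δ-> : ∀ {i m} → i < m → δ i m ≡ 0ℤ
δ-> {zero}  {suc m} _         = refl
δ-> {suc i} {suc m} (s≤s i<m) = δ-> i<m

δ-diag : ∀ i → δ i i ≡ 1ℤ
δ-diag zero    = refl
δ-diag (suc i) = δ-diag i

Δ^-δ : ∀ k → Δ^ k (δ 0) 0 ≡ -1ℤ ℤ.^ k
Δ^-δ zero    = refl
Δ^-δ (suc k) = begin
  Δ^ k (δ 0) 1 - Δ^ k (δ 0) 0 ≡⟨ cong₂ _-_ (trans (Δ^-local k 1 (λ { (suc m) _ _ → refl })) (Δ^-zero k 1)) (Δ^-δ k) ⟩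
  0ℤ - -1ℤ ℤ.^ k              ≡⟨ ℤP.+-identityˡ _ ⟩
  - (-1ℤ ℤ.^ k)               ≡⟨ sym (ℤP.-1*i≡-i _) ⟩
  -1ℤ ℤ.^ suc k               ∎

C[_] : ℕ → ℕ → ℤ
C[ k ] n = + (n C k)

C[suc]-pascal : ∀ k n → C[ suc k ] (suc n) ≡ C[ k ] n + C[ suc k ] n
C[suc]-pascal k n = trans (cong +_ (sym (nCk+nC[k+1]≡[n+1]C[k+1] n k))) (ℤP.pos-+ (n C k) (n C suc k))

Δ-C[suc] : ∀ k n → Δ C[ suc k ] n ≡ C[ k ] n
Δ-C[suc] k n = trans (cong (_- C[ suc k ] n) (C[suc]-pascal k n)) (lemma (C[ k ] n) (C[ suc k ] n))
  where
  lemma : ∀ (a b : ℤ) → (a + b) - b ≡ a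
  lemma = solve-∀

Δ^-C-< : ∀ m k n → k < m → Δ^ m C[ k ] n ≡ 0ℤ
Δ^-C-< (suc m) zero    n _         = trans (Δ^-suc m C[ 0 ] n) (Δ^-zero m n)
Δ^-C-< (suc m) (suc k) n (s≤s k<m) =
  trans (Δ^-suc m C[ suc k ] n) (trans (Δ^-cong m n (Δ-C[suc] k)) (Δ^-C-< m k n k<m))

Δ^-C-≥ : ∀ m k n → m ≤ k → Δ^ m C[ k ] n ≡ C[ k ∸ m ] n
Δ^-C-≥ zero    k       n _         = refl
Δ^-C-≥ (suc m) (suc k) n (s≤s m≤k) =
  trans (Δ^-suc m C[ suc k ] n) (trans (Δ^-cong m n (Δ-C[suc] k)) (Δ^-C-≥ m k n m≤k))

binomialTransform : (ℕ → ℤ) → ℕ → ℤ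
binomialTransform e n = ∑[ j < suc n ] (e j * C[ j ] n)

transform-cong : ∀ {e e′ : ℕ → ℤ} n → (∀ j → e j ≡ e′ j) → binomialTransform e n ≡ binomialTransform e′ n
transform-cong n e≡e′ = ∑-cong (suc n) (λ j _ → cong (_* C[ j ] n) (e≡e′ j))

transform-at-0 : ∀ (e : ℕ → ℤ) → binomialTransform e 0 ≡ e 0
transform-at-0 e = trans (ℤP.+-identityʳ _) (ℤP.*-identityʳ (e 0))

transform-+ : ∀ (e e′ : ℕ → ℤ) n →
  binomialTransform (λ j → e j + e′ j) n ≡ binomialTransform e n + binomialTransform e′ n
transform-+ e e′ n = trans (∑-cong (suc n) (λ j _ → ℤP.*-distribʳ-+ (C[ j ] n) (e j) (e′ j)))
  (∑-distrib-+ (suc n) (λ j → e j * C[ j ] n) (λ j → e′ j * C[ j ] n))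

transform-- : ∀ (e e′ : ℕ → ℤ) n →
  binomialTransform (λ j → e j - e′ j) n ≡ binomialTransform e n - binomialTransform e′ n
transform-- e e′ n = trans (∑-cong (suc n) (λ j _ → lemma (e j) (e′ j) (C[ j ] n)))
  (∑-distrib-- (suc n) (λ j → e j * C[ j ] n) (λ j → e′ j * C[ j ] n))
  where
  lemma : ∀ (a b c : ℤ) → (a - b) * c ≡ a * c - b * c
  lemma = solve-∀

transform-zero : ∀ {e : ℕ → ℤ} n → (∀ j → e j ≡ 0ℤ) → binomialTransform e n ≡ 0ℤ
transform-zero n e≡0 = ∑-zero (suc n) (λ j _ → trans (cong (_* C[ j ] n) (e≡0 j)) (ℤP.*-zeroˡ (C[ j ] n)))

transform-pascal : ∀ (e : ℕ → ℤ) n →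
  binomialTransform e (suc n) ≡ binomialTransform e n + binomialTransform (e ∘ suc) n
transform-pascal e n = begin
  e 0 * 1ℤ + ∑[ j < suc n ] (e (suc j) * C[ suc j ] (suc n))
    ≡⟨ cong (_+_ (e 0 * 1ℤ)) (trans (∑-cong (suc n) (λ j _ → pascal j)) (∑-distrib-+ (suc n) (λ j → e (suc j) * C[ j ] n) (λ j → e (suc j) * C[ suc j ] n))) ⟩
  e 0 * 1ℤ + (binomialTransform (e ∘ suc) n + R)
    ≡⟨ lemma (e 0 * 1ℤ) (binomialTransform (e ∘ suc) n) R ⟩
  binomialTransform (e ∘ suc) n + (e 0 * 1ℤ + R)
    ≡⟨ cong (_+_ (binomialTransform (e ∘ suc) n)) widen ⟩
  binomialTransform (e ∘ suc) n + binomialTransform e n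
    ≡⟨ ℤP.+-comm (binomialTransform (e ∘ suc) n) (binomialTransform e n) ⟩
  binomialTransform e n + binomialTransform (e ∘ suc) n ∎
  where
  R = ∑[ j < suc n ] (e (suc j) * C[ suc j ] n)
  pascal : ∀ j → e (suc j) * C[ suc j ] (suc n) ≡ e (suc j) * C[ j ] n + e (suc j) * C[ suc j ] n
  pascal j = trans (cong (e (suc j) *_) (C[suc]-pascal j n)) (ℤP.*-distribˡ-+ (e (suc j)) _ _)
  lemma : ∀ (x a b : ℤ) → x + (a + b) ≡ a + (x + b)
  lemma = solve-∀
  widen : ∑[ j < suc (suc n) ] (e j * C[ j ] n) ≡ binomialTransform e n
  widen = begin
    ∑[ j < suc (suc n) ] (e j * C[ j ] n)        ≡⟨ ∑-last (suc n) (λ j → e j * C[ j ] n) ⟩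
    binomialTransform e n + e (suc n) * C[ suc n ] n ≡⟨ cong (λ c → binomialTransform e n + e (suc n) * + c) (k>n⇒nCk≡0 (ℕP.n<1+n n)) ⟩
    binomialTransform e n + e (suc n) * 0ℤ         ≡⟨ cong (_+_ (binomialTransform e n)) (ℤP.*-zeroʳ (e (suc n))) ⟩
    binomialTransform e n + 0ℤ                     ≡⟨ ℤP.+-identityʳ _ ⟩
    binomialTransform e n                          ∎

Δ^-transform : ∀ k (e : ℕ → ℤ) n → Δ^ k (binomialTransform e) n ≡ binomialTransform (λ j → e (k ℕ.+ j)) n
Δ^-transform zero    e n = refl
Δ^-transform (suc k) e n = begin
  Δ^ k (binomialTransform e) (suc n) - Δ^ k (binomialTransform e) n
    ≡⟨ cong₂ _-_ (trans (Δ^-transform k e (suc n)) (transform-pascal e′ n)) (Δ^-transform k e n) ⟩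
  (binomialTransform e′ n + binomialTransform (e′ ∘ suc) n) - binomialTransform e′ n
    ≡⟨ lemma (binomialTransform e′ n) (binomialTransform (e′ ∘ suc) n) ⟩
  binomialTransform (e′ ∘ suc) n
    ≡⟨ transform-cong n (λ j → cong e (ℕP.+-suc k j)) ⟩
  binomialTransform (λ j → e (suc k ℕ.+ j)) n ∎
  where
  e′ = λ j → e (k ℕ.+ j)
  lemma : ∀ (a b : ℤ) → (a + b) - a ≡ b
  lemma = solve-∀

transform-vanishing⇒alternating : ∀ (u : ℕ → ℤ) → (∀ m → binomialTransform u (suc m) ≡ 0ℤ) →
  ∀ j → u j ≡ u 0 * -1ℤ ℤ.^ j
transform-vanishing⇒alternating u vanish j = begin
  u j                                         ≡⟨ cong u (sym (ℕP.+-identityʳ j)) ⟩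
  u (j ℕ.+ 0)                                 ≡⟨ sym (transform-at-0 (λ i → u (j ℕ.+ i))) ⟩
  binomialTransform (λ i → u (j ℕ.+ i)) 0     ≡⟨ sym (Δ^-transform j u 0) ⟩
  Δ^ j (binomialTransform u) 0                ≡⟨ Δ^-cong j 0 concentrated ⟩
  Δ^ j (λ m → u 0 * δ 0 m) 0                  ≡⟨ Δ^-* j (u 0) (δ 0) 0 ⟩
  u 0 * Δ^ j (δ 0) 0                          ≡⟨ cong (u 0 *_) (Δ^-δ j) ⟩
  u 0 * -1ℤ ℤ.^ j                             ∎
  where
  concentrated : ∀ m → binomialTransform u m ≡ u 0 * δ 0 m
  concentrated zero    = trans (transform-at-0 u) (sym (ℤP.*-identityʳ (u 0)))
  concentrated (suc m) = trans (vanish m) (sym (ℤP.*-zeroʳ (u 0)))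

-1^-even : ∀ n → -1ℤ ℤ.^ (2 ℕ.* n) ≡ 1ℤ
-1^-even n = trans (sym (ℤP.^-*-assoc -1ℤ 2 n)) (ℤP.^-zeroˡ n)

transform-vanishing⇒antiperiodic≡0 : ∀ h (u : ℕ → ℤ) → (∀ j → u (2 ℕ.* h ℕ.+ j) ≡ - u j) →
  (∀ m → binomialTransform u (suc m) ≡ 0ℤ) → ∀ j → u j ≡ 0ℤ
transform-vanishing⇒antiperiodic≡0 h u antiperiodic vanish j =
  trans (alternates j) (trans (cong (_* -1ℤ ℤ.^ j) u0≡0) (ℤP.*-zeroˡ (-1ℤ ℤ.^ j)))
  where
  alternates = transform-vanishing⇒alternating u vanish
  u0≡-u0 : u 0 ≡ - u 0
  u0≡-u0 = begin
    u 0               ≡⟨ sym (trans (alternates (2 ℕ.* h)) (trans (cong (u 0 *_) (-1^-even h)) (ℤP.*-identityʳ (u 0)))) ⟩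
    u (2 ℕ.* h)       ≡⟨ cong u (sym (ℕP.+-identityʳ (2 ℕ.* h))) ⟩
    u (2 ℕ.* h ℕ.+ 0) ≡⟨ antiperiodic 0 ⟩
    - u 0             ∎
  lemma : ∀ x → x * + 2 ≡ x + x
  lemma = solve-∀
  u0≡0 : u 0 ≡ 0ℤ
  u0≡0 = ℤP.*-cancelʳ-≡ (u 0) 0ℤ (+ 2) (trans (lemma (u 0)) (trans (cong (_+_ (u 0)) u0≡-u0) (ℤP.+-inverseʳ (u 0))))

-- Polynomials acting on sequences

-- act p X is p(E) X for the shift E X n = X (suc n).
act : Poly → (ℕ → ℤ) → ℕ → ℤ
act []      X n = 0ℤ
act (c ∷ p) X n = c * X n + act p X (suc n)

act-cong : ∀ p {X Y : ℕ → ℤ} → (∀ m → X m ≡ Y m) → ∀ n → act p X n ≡ act p Y n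
act-cong []      X≡Y n = refl
act-cong (c ∷ p) X≡Y n = cong₂ (λ x a → c * x + a) (X≡Y n) (act-cong p X≡Y (suc n))

act-shift : ∀ p (X : ℕ → ℤ) n → act p (X ∘ suc) n ≡ act p X (suc n)
act-shift []      X n = refl
act-shift (c ∷ p) X n = cong (_+_ (c * X (suc n))) (act-shift p X (suc n))

act-0 : ∀ p n → act p (λ _ → 0ℤ) n ≡ 0ℤ
act-0 []      n = refl
act-0 (c ∷ p) n = cong₂ _+_ (ℤP.*-zeroʳ c) (act-0 p (suc n))

act-+ : ∀ p (X Y : ℕ → ℤ) n → act p (λ m → X m + Y m) n ≡ act p X n + act p Y n
act-+ []      X Y n = refl
act-+ (c ∷ p) X Y n = trans (cong₂ _+_ (ℤP.*-distribˡ-+ c (X n) (Y n)) (act-+ p X Y (suc n)))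
  (+-interchange (c * X n) (c * Y n) (act p X (suc n)) (act p Y (suc n)))

act-* : ∀ p c (X : ℕ → ℤ) n → act p (λ m → c * X m) n ≡ c * act p X n
act-* []      c X n = sym (ℤP.*-zeroʳ c)
act-* (d ∷ p) c X n = trans (cong₂ _+_ (x∙yz≈y∙xz d c (X n)) (act-* p c X (suc n)))
  (sym (ℤP.*-distribˡ-+ c (d * X n) (act p X (suc n))))

act-- : ∀ p (X Y : ℕ → ℤ) n → act p (λ m → X m - Y m) n ≡ act p X n - act p Y n
act-- p X Y n = begin
  act p (λ m → X m - Y m) n         ≡⟨ act-cong p (λ m → cong (_+_ (X m)) (sym (ℤP.-1*i≡-i (Y m)))) n ⟩
  act p (λ m → X m + -1ℤ * Y m) n   ≡⟨ act-+ p X (λ m → -1ℤ * Y m) n ⟩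
  act p X n + act p (λ m → -1ℤ * Y m) n ≡⟨ cong (_+_ (act p X n)) (trans (act-* p -1ℤ Y n) (ℤP.-1*i≡-i _)) ⟩
  act p X n - act p Y n             ∎

act-Δ^ : ∀ p k (X : ℕ → ℤ) n → act p (Δ^ k X) n ≡ Δ^ k (act p X) n
act-Δ^ p zero    X n = refl
act-Δ^ p (suc k) X n = begin
  act p (λ m → Δ^ k X (suc m) - Δ^ k X m) n   ≡⟨ act-- p (Δ^ k X ∘ suc) (Δ^ k X) n ⟩
  act p (Δ^ k X ∘ suc) n - act p (Δ^ k X) n   ≡⟨ cong (_- act p (Δ^ k X) n) (act-shift p (Δ^ k X) n) ⟩
  act p (Δ^ k X) (suc n) - act p (Δ^ k X) n   ≡⟨ cong₂ _-_ (act-Δ^ p k X (suc n)) (act-Δ^ p k X n) ⟩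
  Δ^ (suc k) (act p X) n                      ∎

act-+ₚ : ∀ p q (X : ℕ → ℤ) n → act (p +ₚ q) X n ≡ act p X n + act q X n
act-+ₚ []      q       X n = sym (ℤP.+-identityˡ (act q X n))
act-+ₚ (c ∷ p) []      X n = sym (ℤP.+-identityʳ (act (c ∷ p) X n))
act-+ₚ (c ∷ p) (d ∷ q) X n = trans (cong₂ _+_ (ℤP.*-distribʳ-+ (X n) c d) (act-+ₚ p q X (suc n)))
  (+-interchange (c * X n) (d * X n) (act p X (suc n)) (act q X (suc n)))

act-·ₚ : ∀ c p (X : ℕ → ℤ) n → act (c ·ₚ p) X n ≡ c * act p X n
act-·ₚ c []      X n = sym (ℤP.*-zeroʳ c)
act-·ₚ c (d ∷ p) X n = trans (cong₂ _+_ (ℤP.*-assoc c d (X n)) (act-·ₚ c p X (suc n)))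
  (sym (ℤP.*-distribˡ-+ c (d * X n) (act p X (suc n))))

act-*ₚ : ∀ p q (X : ℕ → ℤ) n → act (p *ₚ q) X n ≡ act q (act p X) n
act-*ₚ []      q X n = sym (act-0 q n)
act-*ₚ (c ∷ p) q X n = begin
  act (c ·ₚ q +ₚ (0ℤ ∷ p *ₚ q)) X n
    ≡⟨ act-+ₚ (c ·ₚ q) (0ℤ ∷ p *ₚ q) X n ⟩
  act (c ·ₚ q) X n + (0ℤ * X n + act (p *ₚ q) X (suc n))
    ≡⟨ cong₂ _+_ (trans (act-·ₚ c q X n) (sym (act-* q c X n)))
                 (trans (ℤP.+-identityˡ (act (p *ₚ q) X (suc n))) (act-*ₚ p q X (suc n))) ⟩
  act q (λ m → c * X m) n + act q (act p X) (suc n)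
    ≡⟨ cong (_+_ (act q (λ m → c * X m) n)) (sym (act-shift q (act p X) n)) ⟩
  act q (λ m → c * X m) n + act q (act p X ∘ suc) n
    ≡⟨ sym (act-+ q (λ m → c * X m) (act p X ∘ suc) n) ⟩
  act q (act (c ∷ p) X) n ∎

act-coeff-cong : ∀ p q → (∀ i → coeff p i ≡ coeff q i) → ∀ (X : ℕ → ℤ) n → act p X n ≡ act q X n
act-coeff-cong []      []      p≡q X n = refl
act-coeff-cong []      (d ∷ q) p≡q X n =
  cong₂ _+_ (trans (sym (ℤP.*-zeroˡ (X n))) (cong (_* X n) (p≡q 0))) (act-coeff-cong [] q (p≡q ∘ suc) X (suc n))
act-coeff-cong (c ∷ p) []      p≡q X n =
  cong₂ _+_ (trans (cong (_* X n) (p≡q 0)) (ℤP.*-zeroˡ (X n))) (act-coeff-cong p [] (p≡q ∘ suc) X (suc n))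
act-coeff-cong (c ∷ p) (d ∷ q) p≡q X n =
  cong₂ _+_ (cong (_* X n) (p≡q 0)) (act-coeff-cong p q (p≡q ∘ suc) X (suc n))

act-window : ∀ p L → (∀ i → L ≤ i → coeff p i ≡ 0ℤ) →
  ∀ (X : ℕ → ℤ) n → act p X n ≡ ∑[ i < L ] (coeff p i * X (n ℕ.+ i))
act-window []      L       _      X n = sym (∑-zero L (λ i _ → ℤP.*-zeroˡ (X (n ℕ.+ i))))
act-window (c ∷ p) zero    p≥L≡0 X n =
  cong₂ _+_ (trans (cong (_* X n) (p≥L≡0 0 z≤n)) (ℤP.*-zeroˡ (X n))) (act-window p 0 (λ i _ → p≥L≡0 (suc i) z≤n) X (suc n))
act-window (c ∷ p) (suc L) p≥L≡0 X n = cong₂ _+_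
  (cong (λ m → c * X m) (sym (ℕP.+-identityʳ n)))
  (trans (act-window p L (λ i L≤i → p≥L≡0 (suc i) (s≤s L≤i)) X (suc n))
         (∑-cong L (λ i _ → cong (λ m → coeff p i * X m) (sym (ℕP.+-suc n i)))))

act-δ : ∀ p i → act p (δ i) 0 ≡ coeff p i
act-δ []      i       = refl
act-δ (c ∷ p) zero    = trans (cong₂ _+_ (ℤP.*-identityʳ c) (trans (sym (act-shift p (δ 0) 0)) (act-0 p 0)))
  (ℤP.+-identityʳ c)
act-δ (c ∷ p) (suc i) = trans (cong₂ _+_ (ℤP.*-zeroʳ c) (sym (act-shift p (δ (suc i)) 0)))
  (trans (ℤP.+-identityˡ _) (act-δ p i))

act-∘ₚ : ∀ c p q (X : ℕ → ℤ) n → act ((c ∷ p) ∘ₚ q) X n ≡ c * X n + act (p ∘ₚ q) (act q X) n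
act-∘ₚ c p q X n = trans (act-+ₚ [ c ] (q *ₚ (p ∘ₚ q)) X n)
  (cong₂ _+_ (ℤP.+-identityʳ (c * X n)) (act-*ₚ q (p ∘ₚ q) X n))

act-x-1 : ∀ (X : ℕ → ℤ) n → act xMinus1 X n ≡ Δ X n
act-x-1 X n = lemma (X n) (X (suc n))
  where
  lemma : ∀ (x y : ℤ) → -1ℤ * x + (1ℤ * y + 0ℤ) ≡ y - x
  lemma = solve-∀

infix 30 x^_
x^_ : ℕ → Poly
x^ zero  = [ 1ℤ ]
x^ suc K = 0ℤ ∷ x^ K

act-x^∘x-1 : ∀ K (X : ℕ → ℤ) n → act (x^ K ∘ₚ xMinus1) X n ≡ Δ^ K X n
act-x^∘x-1 zero    X n = trans (act-∘ₚ 1ℤ [] xMinus1 X n) (trans (ℤP.+-identityʳ (1ℤ * X n)) (ℤP.*-identityˡ (X n)))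
act-x^∘x-1 (suc K) X n = begin
  act (x^ suc K ∘ₚ xMinus1) X n               ≡⟨ act-∘ₚ 0ℤ (x^ K) xMinus1 X n ⟩
  0ℤ * X n + act (x^ K ∘ₚ xMinus1) (act xMinus1 X) n ≡⟨ ℤP.+-identityˡ _ ⟩
  act (x^ K ∘ₚ xMinus1) (act xMinus1 X) n     ≡⟨ act-cong (x^ K ∘ₚ xMinus1) (act-x-1 X) n ⟩
  act (x^ K ∘ₚ xMinus1) (Δ X) n               ≡⟨ act-x^∘x-1 K (Δ X) n ⟩
  Δ^ K (Δ X) n                                ≡⟨ sym (Δ^-suc K X n) ⟩
  Δ^ (suc K) X n                              ∎

x^-unique : ∀ {f : ℕ → Poly} → f 0 ≡ x^ 0 → (∀ K → f (suc K) ≡ 0ℤ ∷ f K) → ∀ K → f K ≡ x^ K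
x^-unique f0 fsuc zero    = f0
x^-unique f0 fsuc (suc K) = trans (fsuc K) (cong (0ℤ ∷_) (x^-unique f0 fsuc K))

-- The padding list of Φ2^ is local to Defs; abstracting its length and leaving the
-- left-hand side of pad≡x^ to unification identifies it with x^_.
mutual
  pad≡x^ : ∀ (r K : ℕ) → _ ≡ x^ K
  pad≡x^ r = x^-unique refl (λ _ → refl)

  Φ2^-suc : ∀ r → Φ2^ (suc r) ≡ 1ℤ ∷ x^ (2 ℕ.^ r ∸ 1)
  Φ2^-suc r with 2 ℕ.^ r ∸ 1
  ... | K = cong (1ℤ ∷_) (pad≡x^ r K)

act-Φ2^∘x-1 : ∀ a (X : ℕ → ℤ) n → act (Φ2^ (suc a) ∘ₚ xMinus1) X n ≡ X n + Δ^ (2 ℕ.^ a) X n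
act-Φ2^∘x-1 a X n = begin
  act (Φ2^ (suc a) ∘ₚ xMinus1) X n                 ≡⟨ cong (λ p → act (p ∘ₚ xMinus1) X n) (Φ2^-suc a) ⟩
  act ((1ℤ ∷ x^ K) ∘ₚ xMinus1) X n                  ≡⟨ act-∘ₚ 1ℤ (x^ K) xMinus1 X n ⟩
  1ℤ * X n + act (x^ K ∘ₚ xMinus1) (act xMinus1 X) n ≡⟨ cong₂ _+_ (ℤP.*-identityˡ (X n)) (act-x^∘x-1 K (act xMinus1 X) n) ⟩
  X n + Δ^ K (act xMinus1 X) n                      ≡⟨ cong (_+_ (X n)) (Δ^-cong K n (act-x-1 X)) ⟩
  X n + Δ^ K (Δ X) n                                ≡⟨ cong (_+_ (X n)) (sym (Δ^-suc K X n)) ⟩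
  X n + Δ^ (suc K) X n                              ≡⟨ cong (λ k → X n + Δ^ k X n) (ℕP.m+[n∸m]≡n (ℕP.m^n>0 2 a)) ⟩
  X n + Δ^ (2 ℕ.^ a) X n                            ∎
  where
  K = 2 ℕ.^ a ∸ 1

act-++ : ∀ p q (X : ℕ → ℤ) n → act (p ++ q) X n ≡ act p X n + act q X (n ℕ.+ length p)
act-++ []      q X n = trans (cong (act q X) (sym (ℕP.+-identityʳ n))) (sym (ℤP.+-identityˡ _))
act-++ (c ∷ p) q X n = begin
  c * X n + act (p ++ q) X (suc n)                                ≡⟨ cong (_+_ (c * X n)) (act-++ p q X (suc n)) ⟩
  c * X n + (act p X (suc n) + act q X (suc n ℕ.+ length p))      ≡⟨ cong (λ m → c * X n + (act p X (suc n) + act q X m)) (sym (ℕP.+-suc n (length p))) ⟩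
  c * X n + (act p X (suc n) + act q X (n ℕ.+ suc (length p)))    ≡⟨ sym (ℤP.+-assoc (c * X n) _ _) ⟩
  act (c ∷ p) X n + act q X (n ℕ.+ length (c ∷ p))                ∎

act-reverse : ∀ c l (X : ℕ → ℤ) n →
  act (reverse (c ∷ l)) X n ≡ c * X (n ℕ.+ length l) + recSum l X (n ℕ.+ length l)
act-reverse c []      X n = trans (ℤP.+-identityʳ (c * X n)) (sym (trans (ℤP.+-identityʳ _) (cong (λ m → c * X m) (ℕP.+-identityʳ n))))
act-reverse c (d ∷ l) X n = begin
  act (reverse (c ∷ d ∷ l)) X n
    ≡⟨ cong (λ p → act p X n) (LP.unfold-reverse c (d ∷ l)) ⟩
  act (reverse (d ∷ l) ++ [ c ]) X n
    ≡⟨ act-++ (reverse (d ∷ l)) [ c ] X n ⟩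
  act (reverse (d ∷ l)) X n + (c * X (n ℕ.+ length (reverse (d ∷ l))) + 0ℤ)
    ≡⟨ cong₂ (λ a m → a + (c * X (n ℕ.+ m) + 0ℤ)) (act-reverse d l X n) (LP.length-reverse (d ∷ l)) ⟩
  (d * X (n ℕ.+ L) + recSum l X (n ℕ.+ L)) + (c * X (n ℕ.+ suc L) + 0ℤ)
    ≡⟨ lemma (d * X (n ℕ.+ L) + recSum l X (n ℕ.+ L)) (c * X (n ℕ.+ suc L)) ⟩
  c * X (n ℕ.+ suc L) + (d * X (n ℕ.+ L) + recSum l X (n ℕ.+ L))
    ≡⟨ cong (λ m → c * X (n ℕ.+ suc L) + (d * X m + recSum l X m)) (sym (cong (_∸ 1) (ℕP.+-suc n L))) ⟩
  c * X (n ℕ.+ suc L) + recSum (d ∷ l) X (n ℕ.+ suc L) ∎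
  where
  L = length l
  lemma : ∀ (a b : ℤ) → a + (b + 0ℤ) ≡ b + a
  lemma = solve-∀

recSum-neg : ∀ as (X : ℕ → ℤ) m → recSum (map -_ as) X m ≡ - recSum as X m
recSum-neg []       X m = refl
recSum-neg (a ∷ as) X m = begin
  - a * X (m ∸ 1) + recSum (map -_ as) X (m ∸ 1)   ≡⟨ cong₂ _+_ (sym (ℤP.neg-distribˡ-* a (X (m ∸ 1)))) (recSum-neg as X (m ∸ 1)) ⟩
  - (a * X (m ∸ 1)) + - recSum as X (m ∸ 1)        ≡⟨ sym (ℤP.neg-distrib-+ (a * X (m ∸ 1)) (recSum as X (m ∸ 1))) ⟩
  - recSum (a ∷ as) X m                             ∎

act-charPoly : ∀ as (X : ℕ → ℤ) n →
  act (charPoly as) X n ≡ X (n ℕ.+ length as) - recSum as X (n ℕ.+ length as)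
act-charPoly as X n = begin
  act (reverse (1ℤ ∷ map -_ as)) X n
    ≡⟨ act-reverse 1ℤ (map -_ as) X n ⟩
  1ℤ * X (n ℕ.+ length (map -_ as)) + recSum (map -_ as) X (n ℕ.+ length (map -_ as))
    ≡⟨ cong (λ m → 1ℤ * X (n ℕ.+ m) + recSum (map -_ as) X (n ℕ.+ m)) (LP.length-map -_ as) ⟩
  1ℤ * X (n ℕ.+ length as) + recSum (map -_ as) X (n ℕ.+ length as)
    ≡⟨ cong₂ _+_ (ℤP.*-identityˡ (X (n ℕ.+ length as))) (recSum-neg as X (n ℕ.+ length as)) ⟩
  X (n ℕ.+ length as) - recSum as X (n ℕ.+ length as) ∎

charPoly-annihilates : ∀ {X : ℕ → ℤ} {as} → Satisfies X as → ∀ n → 1 ≤ n → act (charPoly as) X n ≡ 0ℤ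
charPoly-annihilates {X} {as} satisfies n 1≤n = begin
  act (charPoly as) X n                                     ≡⟨ act-charPoly as X n ⟩
  X (n ℕ.+ length as) - recSum as X (n ℕ.+ length as)       ≡⟨ cong (_- recSum as X (n ℕ.+ length as)) (satisfies (n ℕ.+ length as) (ℕP.m<n+m (length as) 1≤n)) ⟩
  recSum as X (n ℕ.+ length as) - recSum as X (n ℕ.+ length as) ≡⟨ ℤP.+-inverseʳ (recSum as X (n ℕ.+ length as)) ⟩
  0ℤ                                                        ∎

-- Division by a monic polynomial

coeff-+ₚ : ∀ p q i → coeff (p +ₚ q) i ≡ coeff p i + coeff q i
coeff-+ₚ []      q       i       = sym (ℤP.+-identityˡ (coeff q i))
coeff-+ₚ (c ∷ p) []      i       = sym (ℤP.+-identityʳ (coeff (c ∷ p) i))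
coeff-+ₚ (c ∷ p) (d ∷ q) zero    = refl
coeff-+ₚ (c ∷ p) (d ∷ q) (suc i) = coeff-+ₚ p q i

coeff-·ₚ : ∀ c p i → coeff (c ·ₚ p) i ≡ c * coeff p i
coeff-·ₚ c []      i       = sym (ℤP.*-zeroʳ c)
coeff-·ₚ c (d ∷ p) zero    = refl
coeff-·ₚ c (d ∷ p) (suc i) = coeff-·ₚ c p i

coeff-*ₚ-[] : ∀ p i → coeff (p *ₚ []) i ≡ 0ℤ
coeff-*ₚ-[] []      i       = refl
coeff-*ₚ-[] (c ∷ p) zero    = refl
coeff-*ₚ-[] (c ∷ p) (suc i) = coeff-*ₚ-[] p i

coeff-*ₚ-∷ : ∀ p t q i → coeff (p *ₚ (t ∷ q)) i ≡ t * coeff p i + coeff (0ℤ ∷ p *ₚ q) i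
coeff-*ₚ-∷ []      t q i       = sym (cong₂ _+_ (ℤP.*-zeroʳ t) (zero∷[] i))
  where
  zero∷[] : ∀ i → coeff (0ℤ ∷ []) i ≡ 0ℤ
  zero∷[] zero    = refl
  zero∷[] (suc i) = refl
coeff-*ₚ-∷ (c ∷ p) t q zero    = trans (ℤP.+-identityʳ (c * t)) (sym (trans (ℤP.+-identityʳ (t * c)) (ℤP.*-comm t c)))
coeff-*ₚ-∷ (c ∷ p) t q (suc i) = begin
  coeff (c ·ₚ q +ₚ p *ₚ (t ∷ q)) i                 ≡⟨ coeff-+ₚ (c ·ₚ q) (p *ₚ (t ∷ q)) i ⟩
  coeff (c ·ₚ q) i + coeff (p *ₚ (t ∷ q)) i        ≡⟨ cong (_+_ (coeff (c ·ₚ q) i)) (coeff-*ₚ-∷ p t q i) ⟩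
  coeff (c ·ₚ q) i + (t * coeff p i + coeff (0ℤ ∷ p *ₚ q) i)
    ≡⟨ x∙yz≈y∙xz⁺ (coeff (c ·ₚ q) i) (t * coeff p i) (coeff (0ℤ ∷ p *ₚ q) i) ⟩
  t * coeff p i + (coeff (c ·ₚ q) i + coeff (0ℤ ∷ p *ₚ q) i)
    ≡⟨ cong (_+_ (t * coeff p i)) (sym (coeff-+ₚ (c ·ₚ q) (0ℤ ∷ p *ₚ q) i)) ⟩
  t * coeff p i + coeff (c ·ₚ q +ₚ (0ℤ ∷ p *ₚ q)) i ∎

divide-by-monic : ∀ {G M} → coeff G M ≡ 1ℤ → (∀ i → M < i → coeff G i ≡ 0ℤ) → ∀ f →
  ∃[ q ] ∃[ r ] ((∀ i → M ≤ i → coeff r i ≡ 0ℤ) × (∀ i → coeff f i ≡ coeff (G *ₚ q +ₚ r) i))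
divide-by-monic {G} monic degree≤M [] =
  [] , [] , (λ _ _ → refl) , λ i → sym (trans (coeff-+ₚ (G *ₚ []) [] i) (trans (ℤP.+-identityʳ _) (coeff-*ₚ-[] G i)))
divide-by-monic {G} {M} monic degree≤M (c ∷ f) with divide-by-monic {G} monic degree≤M f
... | q , r , r-small , f≡Gq+r = t ∷ q , r′ , r′-small , c∷f≡
  where
  -- t x^M is the leading term of c + x r, so subtracting t G brings the degree below M.
  t = coeff (c ∷ r) M
  r′ = (c ∷ r) +ₚ (- t) ·ₚ G

  coeff-r′ : ∀ i → coeff r′ i ≡ coeff (c ∷ r) i - t * coeff G i
  coeff-r′ i = trans (coeff-+ₚ (c ∷ r) ((- t) ·ₚ G) i)
    (cong (_+_ (coeff (c ∷ r) i)) (trans (coeff-·ₚ (- t) G i) (sym (ℤP.neg-distribˡ-* t (coeff G i)))))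

  r′-small : ∀ i → M ≤ i → coeff r′ i ≡ 0ℤ
  r′-small i M≤i with ℕP.m≤n⇒m<n∨m≡n M≤i
  ... | inj₂ refl = trans (coeff-r′ M) (trans (cong (λ g → t - t * g) monic)
                      (trans (cong (_-_ t) (ℤP.*-identityʳ t)) (ℤP.+-inverseʳ t)))
  r′-small (suc i) M≤i | inj₁ M<1+i = trans (coeff-r′ (suc i))
    (trans (cong₂ (λ a g → a - t * g) (r-small i (ℕP.m<1+n⇒m≤n M<1+i)) (degree≤M (suc i) M<1+i))
           (trans (ℤP.+-identityˡ (- (t * 0ℤ))) (cong -_ (ℤP.*-zeroʳ t))))

  shifted : ∀ i → coeff (c ∷ f) i ≡ coeff (0ℤ ∷ G *ₚ q) i + coeff (c ∷ r) i
  shifted zero    = sym (ℤP.+-identityˡ c)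
  shifted (suc i) = trans (f≡Gq+r i) (coeff-+ₚ (G *ₚ q) r i)

  c∷f≡ : ∀ i → coeff (c ∷ f) i ≡ coeff (G *ₚ (t ∷ q) +ₚ r′) i
  c∷f≡ i = sym (begin
    coeff (G *ₚ (t ∷ q) +ₚ r′) i
      ≡⟨ coeff-+ₚ (G *ₚ (t ∷ q)) r′ i ⟩
    coeff (G *ₚ (t ∷ q)) i + coeff r′ i
      ≡⟨ cong₂ _+_ (coeff-*ₚ-∷ G t q i) (coeff-r′ i) ⟩
    (t * coeff G i + coeff (0ℤ ∷ G *ₚ q) i) + (coeff (c ∷ r) i - t * coeff G i)
      ≡⟨ lemma (t * coeff G i) (coeff (0ℤ ∷ G *ₚ q) i) (coeff (c ∷ r) i) ⟩
    coeff (0ℤ ∷ G *ₚ q) i + coeff (c ∷ r) i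
      ≡⟨ sym (shifted i) ⟩
    coeff (c ∷ f) i ∎)
    where
    lemma : ∀ (a b c : ℤ) → (a + b) + (c - a) ≡ b + c
    lemma = solve-∀

-- An Eisenstein criterion for annihilating polynomials

Annihilates : ℕ → (ℕ → ℤ) → (ℕ → ℤ) → Set
Annihilates L c X = ∀ m → ∑[ i < L ] (c i * X (m ℕ.+ i)) ≡ 0ℤ

∑≡0-÷ : ∀ {d} .{{_ : ℤ.NonZero d}} L {f g : ℕ → ℤ} → (∀ i → i < L → f i ≡ g i * d) →
  ∑< L f ≡ 0ℤ → ∑< L g ≡ 0ℤ
∑≡0-÷ {d} L {f} {g} f≡gd ∑f≡0 = ℤP.*-cancelʳ-≡ (∑< L g) 0ℤ d
  (trans (sym (∑-*ʳ L g d)) (trans (sym (∑-cong L f≡gd)) (trans ∑f≡0 (sym (ℤP.*-zeroˡ d)))))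

annihilates-÷ : ∀ {d} .{{_ : ℤ.NonZero d}} {L c} {X Y : ℕ → ℤ} → (∀ m → X m ≡ Y m * d) →
  Annihilates L c X → Annihilates L c Y
annihilates-÷ {d} {L} {c} {X} {Y} X≡Yd cX m = ∑≡0-÷ L
  (λ i _ → trans (cong (c i *_) (X≡Yd (m ℕ.+ i))) (sym (ℤP.*-assoc (c i) (Y (m ℕ.+ i)) d))) (cX m)

coefficients-÷ : ∀ {d} .{{_ : ℤ.NonZero d}} {L} {c c′ X : ℕ → ℤ} → (∀ i → i < L → c i ≡ c′ i * d) →
  Annihilates L c X → Annihilates L c′ X
coefficients-÷ {d} {L} {c} {c′} {X} c≡c′d cX m = ∑≡0-÷ L
  (λ i i<L → trans (cong (_* X (m ℕ.+ i)) (c≡c′d i i<L)) (lemma (c′ i) d (X (m ℕ.+ i)))) (cX m)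
  where
  lemma : ∀ (a b x : ℤ) → a * b * x ≡ a * x * b
  lemma = solve-∀

∣-pow-suc : ∀ {p K y} → + (p ℕ.^ K) ∣ y → + (p ℕ.^ suc K) ∣ y * + p
∣-pow-suc {p} {K} p^K∣y = subst (_∣ _) (trans (sym (ℤP.pos-* (p ℕ.^ K) p)) (cong +_ (ℕP.*-comm (p ℕ.^ K) p)))
  (∣-*-∣ p^K∣y (∣-refl {+ p}))

1∣ : ∀ z → + 1 ∣ z
1∣ z = divides z (sym (ℤP.*-identityʳ z))

module Eisenstein {p} (p-prime : Prime p) {M} {g : ℕ → ℤ} (g-monic : g M ≡ 1ℤ)
  (p∣g : ∀ l → l < M → + p ∣ g l) (p²∤g₀ : ¬ + p * + p ∣ g 0) where

  instance
    p≢0 : ℤ.NonZero (+ p)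
    p≢0 = prime⇒nonZero p-prime

  1<p : 1 < p
  1<p = ℕ.nonTrivial⇒n>1 p {{prime⇒nonTrivial p-prime}}

  p²∣a·g₀w⇒p∣w : ∀ {a w} → 0 < M → ¬ + p ∣ a → + p * + p ∣ a * (g 0 * w) → + p ∣ w
  p²∣a·g₀w⇒p∣w {a} {w} 0<M p∤a p²∣ag₀w = [ ⊥-elim ∘ p∤au , (λ p∣w → p∣w) ]′ (prime∣*⇒∣⊎∣ p-prime {a * u} {w} p∣auw)
    where
    u = quotient (p∣g 0 0<M)
    g₀≡up : g 0 ≡ u * + p
    g₀≡up = _∣_.equality (p∣g 0 0<M)
    lemma : ∀ (a u w p : ℤ) → a * (u * p * w) ≡ a * u * w * p
    lemma = solve-∀
    p∣auw : + p ∣ a * u * w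
    p∣auw = *-cancelʳ-∣ (+ p) (subst (+ p * + p ∣_) (trans (cong (λ x → a * (x * w)) g₀≡up) (lemma a u w (+ p))) p²∣ag₀w)
    p∤u : ¬ + p ∣ u
    p∤u p∣u = p²∤g₀ (subst (+ p * + p ∣_) (sym g₀≡up) (∣-*-∣ p∣u (∣-refl {+ p})))
    p∤au : ¬ + p ∣ a * u
    p∤au p∣au = [ p∤a , p∤u ]′ (prime∣*⇒∣⊎∣ p-prime {a} {u} p∣au)

  module _ {W : ℕ → ℤ} (gW : Annihilates (suc M) g W) where

    recurrence : ∀ m → W (m ℕ.+ M) ≡ - ∑[ l < M ] (g l * W (m ℕ.+ l))
    recurrence m = solve-for-w (begin
      ∑[ l < M ] (g l * W (m ℕ.+ l)) + 1ℤ * W (m ℕ.+ M)   ≡⟨ cong (λ c → ∑[ l < M ] (g l * W (m ℕ.+ l)) + c * W (m ℕ.+ M)) (sym g-monic) ⟩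
      ∑[ l < M ] (g l * W (m ℕ.+ l)) + g M * W (m ℕ.+ M)  ≡⟨ sym (∑-last M (λ l → g l * W (m ℕ.+ l))) ⟩
      ∑[ l < suc M ] (g l * W (m ℕ.+ l))                  ≡⟨ gW m ⟩
      0ℤ                                                  ∎)
      where
      solve-for-w : ∀ {a w} → a + 1ℤ * w ≡ 0ℤ → w ≡ - a
      solve-for-w {a} {w} a+w≡0 = trans (lemma a w) (trans (cong (_+_ (- a)) a+w≡0) (ℤP.+-identityʳ (- a)))
        where
        lemma : ∀ (a w : ℤ) → w ≡ - a + (a + 1ℤ * w)
        lemma = solve-∀

    p∣W-beyond : ∀ m → M ≤ m → + p ∣ W m
    p∣W-beyond m M≤m = subst (+ p ∣_) (sym W-m≡)
      (∣m⇒∣-m (∣-∑ M (λ l l<M → ∣m⇒∣m*n (W (m ∸ M ℕ.+ l)) (p∣g l l<M))))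
      where
      W-m≡ : W m ≡ - ∑[ l < M ] (g l * W (m ∸ M ℕ.+ l))
      W-m≡ = trans (cong W (sym (ℕP.m∸n+n≡m M≤m))) (recurrence (m ∸ M))

    module _ {f : ℕ → ℤ} (fW : Annihilates M f W) {k} (k<M : k < M)
             (p∣f<k : ∀ i → i < k → + p ∣ f i) (p∤fk : ¬ + p ∣ f k) where

      -- Evaluate the f-relation at m₀ = n + (M − k): its terms f i W (m₀ + i) with i < k are
      -- multiples of p², and for i = k + j the recurrence rewrites W (m₀ + i) through W (n + j + l),
      -- all multiples of p² except f k g₀ W n.
      p∣W-descend : ∀ n → (∀ m → n < m → + p ∣ W m) → + p ∣ W n
      p∣W-descend n p∣W> = p²∣a·g₀w⇒p∣w {f k} {W n} (ℕP.≤-trans (s≤s z≤n) k<M) p∤fk p²∣fk·g₀Wn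
        where
        R = proj₁ (ℕP.m≤n⇒∃[o]m+o≡n k<M)
        M≡ : suc (k ℕ.+ R) ≡ M
        M≡ = proj₂ (ℕP.m≤n⇒∃[o]m+o≡n k<M)
        m₀ = n ℕ.+ suc R
        H : ℕ → ℤ
        H j = ∑[ l < M ] (g l * W (n ℕ.+ j ℕ.+ l))
        A = ∑[ i < k ] (f i * W (m₀ ℕ.+ i))
        B = ∑[ l < k ℕ.+ R ] (g (suc l) * W (n ℕ.+ 0 ℕ.+ suc l))
        Rest = ∑[ j < R ] (f (k ℕ.+ suc j) * - H (suc j))

        tail : ∀ j → W (m₀ ℕ.+ (k ℕ.+ j)) ≡ - H j
        tail j = trans (cong W (trans (index n R k j) (cong (n ℕ.+ j ℕ.+_) M≡))) (recurrence (n ℕ.+ j))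
          where
          index : ∀ n R k j → n ℕ.+ suc R ℕ.+ (k ℕ.+ j) ≡ n ℕ.+ j ℕ.+ suc (k ℕ.+ R)
          index = ℕ-solve-∀

        H₀ : H 0 ≡ g 0 * W n + B
        H₀ = trans (cong (λ L → ∑< L (λ l → g l * W (n ℕ.+ 0 ℕ.+ l))) (sym M≡))
                   (cong (λ m → g 0 * W m + B) (trans (ℕP.+-identityʳ (n ℕ.+ 0)) (ℕP.+-identityʳ n)))

        relation : A + (f k * - (g 0 * W n + B) + Rest) ≡ 0ℤ
        relation = begin
          A + (f k * - (g 0 * W n + B) + Rest)
            ≡⟨ cong (λ x → A + (x + Rest)) (cong₂ (λ i h → f i * - h) (sym (ℕP.+-identityʳ k)) (sym H₀)) ⟩
          A + ∑[ j < suc R ] (f (k ℕ.+ j) * - H j)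
            ≡⟨ cong (_+_ A) (∑-cong (suc R) (λ j _ → cong (f (k ℕ.+ j) *_) (sym (tail j)))) ⟩
          A + ∑[ j < suc R ] (f (k ℕ.+ j) * W (m₀ ℕ.+ (k ℕ.+ j)))
            ≡⟨ sym (∑-split k (suc R) (λ i → f i * W (m₀ ℕ.+ i))) ⟩
          ∑[ i < k ℕ.+ suc R ] (f i * W (m₀ ℕ.+ i))
            ≡⟨ cong (λ L → ∑< L (λ i → f i * W (m₀ ℕ.+ i))) (trans (ℕP.+-suc k R) M≡) ⟩
          ∑[ i < M ] (f i * W (m₀ ℕ.+ i))
            ≡⟨ fW m₀ ⟩
          0ℤ ∎

        p²∣A : + p * + p ∣ A
        p²∣A = ∣-∑ k (λ i i<k → ∣-*-∣ (p∣f<k i i<k)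
          (p∣W> (m₀ ℕ.+ i) (ℕP.<-≤-trans (ℕP.m<m+n n (s≤s z≤n)) (ℕP.m≤m+n m₀ i))))

        p²∣B : + p * + p ∣ B
        p²∣B = ∣-∑ (k ℕ.+ R) (λ l l<k+R → ∣-*-∣ (p∣g (suc l) (subst (suc l <_) M≡ (s≤s l<k+R)))
          (p∣W> (n ℕ.+ 0 ℕ.+ suc l) (ℕP.≤-<-trans (ℕP.m≤m+n n 0) (ℕP.m<m+n (n ℕ.+ 0) (s≤s z≤n)))))

        p²∣Rest : + p * + p ∣ Rest
        p²∣Rest = ∣-∑ R (λ j _ → ∣n⇒∣m*n (f (k ℕ.+ suc j)) (∣m⇒∣-m (∣-∑ M (λ l l<M → ∣-*-∣ (p∣g l l<M)
          (p∣W> (n ℕ.+ suc j ℕ.+ l) (ℕP.<-≤-trans (ℕP.m<m+n n (s≤s z≤n)) (ℕP.m≤m+n (n ℕ.+ suc j) l)))))))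

        p²∣fk·g₀Wn : + p * + p ∣ f k * (g 0 * W n)
        p²∣fk·g₀Wn = subst (+ p * + p ∣_) (sym isolate)
          (∣m∣n⇒∣m+n (∣m∣n⇒∣m-n p²∣A (∣n⇒∣m*n (f k) p²∣B)) p²∣Rest)
          where
          lemma : ∀ (a x y b r : ℤ) → x * y ≡ (a - x * b + r) - (a + (x * - (y + b) + r))
          lemma = solve-∀
          isolate : f k * (g 0 * W n) ≡ A - f k * B + Rest
          isolate = begin
            f k * (g 0 * W n)                                          ≡⟨ lemma A (f k) (g 0 * W n) B Rest ⟩
            (A - f k * B + Rest) - (A + (f k * - (g 0 * W n + B) + Rest)) ≡⟨ cong (_-_ (A - f k * B + Rest)) relation ⟩
            (A - f k * B + Rest) - 0ℤ                                   ≡⟨ ℤP.+-identityʳ (A - f k * B + Rest) ⟩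
            A - f k * B + Rest                                          ∎

      p∣W : ∀ n → + p ∣ W n
      p∣W n = descend M n (ℕP.m≤n+m M n)
        where
        descend : ∀ d m → M ≤ m ℕ.+ d → + p ∣ W m
        descend zero    m M≤m   = p∣W-beyond m (subst (M ≤_) (ℕP.+-identityʳ m) M≤m)
        descend (suc d) m M≤m+d = p∣W-descend m (λ m′ m<m′ → descend d m′
          (ℕP.≤-trans M≤m+d (ℕP.≤-trans (ℕP.≤-reflexive (ℕP.+-suc m d)) (ℕP.+-monoˡ-≤ d m<m′))))

  -- p-adic descent: dividing W by p preserves both relations, so W is divisible by every power of p.
  sequence-vanishes : ∀ {f k} → k < M → (∀ i → i < k → + p ∣ f i) → ¬ + p ∣ f k →
    ∀ {W} → Annihilates (suc M) g W → Annihilates M f W → ∀ n → W n ≡ 0ℤ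
  sequence-vanishes {f} k<M p∣f<k p∤fk {W} gW fW n = powers∣⇒≡0 1<p (λ K → p^K∣ K {W} gW fW)
    where
    p^K∣ : ∀ K {W} → Annihilates (suc M) g W → Annihilates M f W → + (p ℕ.^ K) ∣ W n
    p^K∣ zero    {W} gW fW = 1∣ (W n)
    p^K∣ (suc K) {W} gW fW = subst (_ ∣_) (sym (W≡W′p n))
      (∣-pow-suc {p} {K} (p^K∣ K {W′} (annihilates-÷ {+ p} {suc M} {g} {W} {W′} W≡W′p gW) (annihilates-÷ {+ p} {M} {f} {W} {W′} W≡W′p fW)))
      where
      p∣W′ = p∣W {W} gW {f} fW k<M p∣f<k p∤fk
      W′ : ℕ → ℤ
      W′ m = quotient (p∣W′ m)
      W≡W′p : ∀ m → W m ≡ W′ m * + p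
      W≡W′p m = _∣_.equality (p∣W′ m)

  coefficients-vanish : ∀ {W} → Annihilates (suc M) g W → ¬ (∀ n → W n ≡ 0ℤ) →
    ∀ {f} → Annihilates M f W → ∀ i → i < M → f i ≡ 0ℤ
  coefficients-vanish {W} gW W≢0 {f} fW i i<M = powers∣⇒≡0 1<p (λ K → p^K∣ K {f} fW)
    where
    p^K∣ : ∀ K {f} → Annihilates M f W → + (p ℕ.^ K) ∣ f i
    p^K∣ zero    {f} fW = 1∣ (f i)
    p^K∣ (suc K) {f} fW with least-failure (λ i → + p ∣? f i) M
    ... | inj₂ (k , k<M , p∣f<k , p∤fk) = ⊥-elim (W≢0 (sequence-vanishes {f} k<M p∣f<k p∤fk {W} gW fW))
    ... | inj₁ p∣f = subst (_ ∣_) (sym (f≡f′p i i<M)) (∣-pow-suc {p} {K} (p^K∣ K {f′} (coefficients-÷ {+ p} {M} {f} {f′} {W} f≡f′p fW)))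
      where
      f′ : ℕ → ℤ
      f′ j with j <? M
      ... | yes j<M = quotient (p∣f j j<M)
      ... | no  _   = 0ℤ
      f≡f′p : ∀ j → j < M → f j ≡ f′ j * + p
      f≡f′p j j<M with j <? M
      ... | yes j<M′ = _∣_.equality (p∣f j j<M′)
      ... | no  j≮M  = ⊥-elim (j≮M j<M)

eisenstein-divides : ∀ {p} → Prime p → ∀ {G M} → coeff G M ≡ 1ℤ → (∀ i → M < i → coeff G i ≡ 0ℤ) →
  (∀ l → l < M → + p ∣ coeff G l) → ¬ + p * + p ∣ coeff G 0 →
  ∀ {W} → ¬ (∀ n → W n ≡ 0ℤ) → (∀ n → act G W n ≡ 0ℤ) →
  ∀ {P} → (∀ n → act P W n ≡ 0ℤ) → G ∣ₚ P
eisenstein-divides p-prime {G} {M} monic degree≤M p∣g p²∤g₀ {W} W≢0 GW {P} PW with divide-by-monic {G} monic degree≤M P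
... | q , r , r-small , P≡Gq+r = q , λ i → trans (P≡Gq+r i) (trans (coeff-+ₚ (G *ₚ q) r i) (remainder-vanishes i))
  where
  open Eisenstein p-prime monic p∣g p²∤g₀

  rW : Annihilates M (coeff r) W
  rW m = begin
    ∑[ i < M ] (coeff r i * W (m ℕ.+ i)) ≡⟨ sym (act-window r M r-small W m) ⟩
    act r W m                            ≡⟨ sym (ℤP.+-identityˡ (act r W m)) ⟩
    0ℤ + act r W m                       ≡⟨ cong (_+ act r W m) (sym (trans (act-*ₚ G q W m) (trans (act-cong q GW m) (act-0 q m)))) ⟩
    act (G *ₚ q) W m + act r W m         ≡⟨ sym (act-+ₚ (G *ₚ q) r W m) ⟩
    act (G *ₚ q +ₚ r) W m                ≡⟨ sym (act-coeff-cong P (G *ₚ q +ₚ r) P≡Gq+r W m) ⟩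
    act P W m                            ≡⟨ PW m ⟩
    0ℤ                                   ∎

  gW : Annihilates (suc M) (coeff G) W
  gW m = trans (sym (act-window G (suc M) degree≤M W m)) (GW m)

  remainder-vanishes : ∀ i → coeff (G *ₚ q) i + coeff r i ≡ coeff (G *ₚ q) i
  remainder-vanishes i with i <? M
  ... | yes i<M = trans (cong (_+_ (coeff (G *ₚ q) i)) (coefficients-vanish {W} gW W≢0 {coeff r} rW i i<M)) (ℤP.+-identityʳ _)
  ... | no  i≮M = trans (cong (_+_ (coeff (G *ₚ q) i)) (r-small i (ℕP.≮⇒≥ i≮M))) (ℤP.+-identityʳ _)

-- The polynomial Φ_{2^(a+1)}(x − 1)

coeff-Φ2^∘x-1 : ∀ a i → coeff (Φ2^ (suc a) ∘ₚ xMinus1) i ≡ δ i 0 + Δ^ (2 ℕ.^ a) (δ i) 0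
coeff-Φ2^∘x-1 a i = trans (sym (act-δ (Φ2^ (suc a) ∘ₚ xMinus1) i)) (act-Φ2^∘x-1 a (δ i) 0)

Φ2^∘x-1-monic : ∀ a → coeff (Φ2^ (suc a) ∘ₚ xMinus1) (2 ℕ.^ a) ≡ 1ℤ
Φ2^∘x-1-monic a = begin
  coeff (Φ2^ (suc a) ∘ₚ xMinus1) M   ≡⟨ coeff-Φ2^∘x-1 a M ⟩
  δ M 0 + Δ^ M (δ M) 0               ≡⟨ cong₂ _+_ (δ-< (ℕP.m^n>0 2 a)) (Δ^-top M 0 (λ m _ m<M → δ-< m<M)) ⟩
  0ℤ + δ M M                         ≡⟨ trans (ℤP.+-identityˡ (δ M M)) (δ-diag M) ⟩
  1ℤ                                 ∎
  where
  M = 2 ℕ.^ a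

Φ2^∘x-1-degree : ∀ a i → 2 ℕ.^ a < i → coeff (Φ2^ (suc a) ∘ₚ xMinus1) i ≡ 0ℤ
Φ2^∘x-1-degree a i M<i = trans (coeff-Φ2^∘x-1 a i) (cong₂ _+_ (δ-< (ℕP.≤-<-trans z≤n M<i))
  (trans (Δ^-local (2 ℕ.^ a) 0 (λ m _ m≤M → δ-< (ℕP.≤-<-trans m≤M M<i))) (Δ^-zero (2 ℕ.^ a) 0)))

Φ2^∘x-1-even : ∀ a l → l < 2 ℕ.^ a → + 2 ∣ coeff (Φ2^ (suc a) ∘ₚ xMinus1) l
Φ2^∘x-1-even a l l<M = subst (+ 2 ∣_) (sym (trans (coeff-Φ2^∘x-1 a l) (lemma (δ l 0) (Δ^ M (δ l) 0) (δ l M))))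
  (∣m∣n⇒∣m+n (∣m∣n⇒∣m+n (frobenius-Δ^ a (δ l) 0) (subst (+ 2 ∣_) (sym (δ-> l<M)) (divides 0ℤ refl)))
             (divides (δ l 0) refl))
  where
  M = 2 ℕ.^ a
  lemma : ∀ (x d y : ℤ) → x + d ≡ (d - y - x) + y + x * + 2
  lemma = solve-∀

Φ2^∘x-1-constant : ∀ a → coeff (Φ2^ (suc (suc a)) ∘ₚ xMinus1) 0 ≡ + 2
Φ2^∘x-1-constant a = trans (coeff-Φ2^∘x-1 (suc a) 0) (cong (_+_ 1ℤ) (trans (Δ^-δ (2 ℕ.^ suc a)) (-1^-even (2 ℕ.^ a))))

¬4∣2 : ¬ + 2 * + 2 ∣ + 2
¬4∣2 4∣2 with ℕ∣.∣⇒≤ (∣⇒∣ᵤ 4∣2)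
... | s≤s (s≤s ())

-- Signs and binomial sums modulo 2

¬2∣1 : ¬ + 2 ∣ 1ℤ
¬2∣1 2∣1 with ℕ∣.∣⇒≤ (∣⇒∣ᵤ 2∣1)
... | s≤s ()

-1^-parity : ∀ n → (-1ℤ ℤ.^ n ≡ 1ℤ × + 2 ∣ + n) ⊎ (-1ℤ ℤ.^ n ≡ -1ℤ × + 2 ∣ + n - 1ℤ)
-1^-parity zero = inj₁ (refl , divides 0ℤ refl)
-1^-parity (suc n) with -1^-parity n
... | inj₁ (-1^n≡1 , 2∣n)    = inj₂ (cong (-1ℤ *_) -1^n≡1 , subst (+ 2 ∣_) (sym (lemma (+ n))) 2∣n)
  where
  lemma : ∀ x → (1ℤ + x) - 1ℤ ≡ x
  lemma = solve-∀
... | inj₂ (-1^n≡-1 , 2∣n-1) = inj₁ (cong (-1ℤ *_) -1^n≡-1 ,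
  subst (+ 2 ∣_) (lemma (+ n)) (∣m∣n⇒∣m+n 2∣n-1 (divides 1ℤ refl)))
  where
  lemma : ∀ x → (x - 1ℤ) + + 2 ≡ 1ℤ + x
  lemma = solve-∀

1≢-1 : 1ℤ ≢ -1ℤ
1≢-1 ()

-1^≡⇒2∣ : ∀ m n → -1ℤ ℤ.^ m ≡ -1ℤ ℤ.^ n → + 2 ∣ + m - + n
-1^≡⇒2∣ m n -1^m≡-1^n with -1^-parity m | -1^-parity n
... | inj₁ (_ , 2∣m)     | inj₁ (_ , 2∣n)     = ∣m∣n⇒∣m-n 2∣m 2∣n
... | inj₂ (_ , 2∣m-1)   | inj₂ (_ , 2∣n-1)   = subst (+ 2 ∣_) (lemma (+ m) (+ n)) (∣m∣n⇒∣m-n 2∣m-1 2∣n-1)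
  where
  lemma : ∀ x y → (x - 1ℤ) - (y - 1ℤ) ≡ x - y
  lemma = solve-∀
... | inj₁ (-1^m≡1 , _)  | inj₂ (-1^n≡-1 , _) = ⊥-elim (1≢-1 (trans (sym -1^m≡1) (trans -1^m≡-1^n -1^n≡-1)))
... | inj₂ (-1^m≡-1 , _) | inj₁ (-1^n≡1 , _)  = ⊥-elim (1≢-1 (trans (sym -1^n≡1) (trans (sym -1^m≡-1^n) -1^m≡-1)))

2∣⇒-1^≡ : ∀ m n → + 2 ∣ + m - + n → -1ℤ ℤ.^ m ≡ -1ℤ ℤ.^ n
2∣⇒-1^≡ m n 2∣m-n with -1^-parity m | -1^-parity n
... | inj₁ (-1^m≡1 , _)  | inj₁ (-1^n≡1 , _)  = trans -1^m≡1 (sym -1^n≡1)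
... | inj₂ (-1^m≡-1 , _) | inj₂ (-1^n≡-1 , _) = trans -1^m≡-1 (sym -1^n≡-1)
... | inj₁ (_ , 2∣m)     | inj₂ (_ , 2∣n-1)   =
  ⊥-elim (¬2∣1 (subst (+ 2 ∣_) (lemma (+ m) (+ n)) (∣m∣n⇒∣m-n (∣m∣n⇒∣m-n 2∣m 2∣m-n) 2∣n-1)))
  where
  lemma : ∀ x y → x - (x - y) - (y - 1ℤ) ≡ 1ℤ
  lemma = solve-∀
... | inj₂ (_ , 2∣m-1)   | inj₁ (_ , 2∣n)     =
  ⊥-elim (¬2∣1 (subst (+ 2 ∣_) (lemma (+ m) (+ n)) (∣m∣n⇒∣m-n (∣m∣n⇒∣m+n 2∣m-n 2∣n) 2∣m-1)))
  where
  lemma : ∀ x y → (x - y) + y - (x - 1ℤ) ≡ 1ℤ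
  lemma = solve-∀

binSumℤ : List ℕ → ℕ → ℤ
binSumℤ ks n = + binSum ks n

Δ^-binSum-∷ : ∀ m k ks j → Δ^ m (binSumℤ (k ∷ ks)) j ≡ Δ^ m C[ k ] j + Δ^ m (binSumℤ ks) j
Δ^-binSum-∷ m k ks j = trans (Δ^-cong m j (λ n → ℤP.pos-+ (n C k) (binSum ks n))) (Δ^-+ m C[ k ] (binSumℤ ks) j)

Δ^-binSum-zero : ∀ m ks j → All (λ k → Δ^ m C[ k ] j ≡ 0ℤ) ks → Δ^ m (binSumℤ ks) j ≡ 0ℤ
Δ^-binSum-zero m []       j []       = Δ^-zero m j
Δ^-binSum-zero m (k ∷ ks) j (h ∷ hs) = trans (Δ^-binSum-∷ m k ks j) (cong₂ _+_ h (Δ^-binSum-zero m ks j hs))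

-- At j = k ∸ m for the least k ≥ m only C(j, k ∸ m) = 1 survives; larger k' give C(j, k' ∸ m) = 0.
Δ^-binSum-one : ∀ m ks → Linked _<_ ks → Any (m ≤_) ks → ∃[ j ] Δ^ m (binSumℤ ks) j ≡ 1ℤ
Δ^-binSum-one m (k ∷ ks) sorted reaches with m ≤? k
... | yes m≤k = j , (begin
  Δ^ m (binSumℤ (k ∷ ks)) j             ≡⟨ Δ^-binSum-∷ m k ks j ⟩
  Δ^ m C[ k ] j + Δ^ m (binSumℤ ks) j   ≡⟨ cong₂ _+_ (trans (Δ^-C-≥ m k j m≤k) (cong +_ (nCn≡1 j))) (Δ^-binSum-zero m ks j later-vanish) ⟩
  1ℤ + 0ℤ                               ∎)
  where
  j = k ∸ m
  later-vanish : All (λ k′ → Δ^ m C[ k′ ] j ≡ 0ℤ) ks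
  later-vanish with Linked⇒AllPairs ℕP.<-trans sorted
  ... | k<ks AllPairs.∷ _ = All.map (λ k<k′ → trans (Δ^-C-≥ m _ j (ℕP.≤-trans m≤k (ℕP.<⇒≤ k<k′)))
                                           (cong +_ (k>n⇒nCk≡0 (ℕP.∸-monoˡ-< k<k′ m≤k)))) k<ks
... | no m≰k with Δ^-binSum-one m ks (Linked.tail sorted) (Any.tail m≰k reaches)
...   | j , Δ^B≡1 = j , trans (Δ^-binSum-∷ m k ks j) (trans (cong₂ _+_ (Δ^-C-< m k j (ℕP.≰⇒> m≰k)) Δ^B≡1) refl)

binSum-even-period : ∀ a ks → All (_< 2 ℕ.^ a) ks → ∀ j → + 2 ∣ binSumℤ ks (j ℕ.+ 2 ℕ.^ a) - binSumℤ ks j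
binSum-even-period a ks bounded j = subst (+ 2 ∣_) (ℤP.+-identityʳ (binSumℤ ks (j ℕ.+ 2 ℕ.^ a) - binSumℤ ks j))
  (subst (λ d → + 2 ∣ (binSumℤ ks (j ℕ.+ 2 ℕ.^ a) - binSumℤ ks j) - d)
         (Δ^-binSum-zero (2 ℕ.^ a) ks j (All.map (λ k< → Δ^-C-< (2 ℕ.^ a) _ j k<) bounded))
         (frobenius-difference a (binSumℤ ks) j))

binSum-odd-jump : ∀ a ks → Linked _<_ ks → Any (2 ℕ.^ a ≤_) ks →
  ∃[ j ] ¬ + 2 ∣ binSumℤ ks (j ℕ.+ 2 ℕ.^ a) - binSumℤ ks j
binSum-odd-jump a ks sorted reaches with Δ^-binSum-one (2 ℕ.^ a) ks sorted reaches
... | j , Δ^B≡1 = j , λ 2∣jump → ¬2∣1 (subst (+ 2 ∣_) (lemma (binSumℤ ks (j ℕ.+ 2 ℕ.^ a) - binSumℤ ks j))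
  (∣m∣n⇒∣m-n 2∣jump (subst (λ d → + 2 ∣ (binSumℤ ks (j ℕ.+ 2 ℕ.^ a) - binSumℤ ks j) - d) Δ^B≡1
                            (frobenius-difference a (binSumℤ ks) j))))
  where
  lemma : ∀ z → z - (z - 1ℤ) ≡ 1ℤ
  lemma = solve-∀

sorted-bounded-by-last : ∀ xs {y} → Linked _<_ (xs ++ [ y ]) → All (_≤ y) (xs ++ [ y ])
sorted-bounded-by-last []           _                = ℕP.≤-refl ∷ []
sorted-bounded-by-last (x ∷ [])     (x<y ∷ _)        = ℕP.<⇒≤ x<y ∷ ℕP.≤-refl ∷ []
sorted-bounded-by-last (x ∷ x′ ∷ xs) (x<x′ ∷ sorted) with sorted-bounded-by-last (x′ ∷ xs) sorted
... | x′≤y ∷ rest = ℕP.<⇒≤ (ℕP.<-≤-trans x<x′ x′≤y) ∷ x′≤y ∷ rest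

sumℤ-applyUpTo : ∀ (f : ℕ → ℤ) (g : ℕ → ℕ) n → sumℤ (map f (applyUpTo g n)) ≡ ∑[ i < n ] f (g i)
sumℤ-applyUpTo f g zero    = refl
sumℤ-applyUpTo f g (suc n) = cong (_+_ (f (g 0))) (sumℤ-applyUpTo f (g ∘ suc) n)

-- The exponential sum S

module ExponentialSum (ks : List ℕ) (a : ℕ) (sorted : Linked _<_ ks)
  (bounded : All (_< 2 ℕ.^ suc (suc a)) ks) (reaches : Any (2 ℕ.^ suc a ≤_) ks) where

  M : ℕ
  M = 2 ℕ.^ suc a

  G : Poly
  G = Φ2^ (suc (suc a)) ∘ₚ xMinus1

  ε : ℕ → ℤ
  ε j = -1ℤ ℤ.^ binSum ks j

  S≡transform : ∀ n → S ks n ≡ binomialTransform ε n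
  S≡transform n = sumℤ-applyUpTo (λ j → ε j * C[ j ] n) (λ j → j) (suc n)

  u : ℕ → ℤ
  u j = ε (M ℕ.+ j) - ε j

  u-antiperiodic : ∀ j → u (M ℕ.+ j) ≡ - u j
  u-antiperiodic j = begin
    ε (M ℕ.+ (M ℕ.+ j)) - ε (M ℕ.+ j) ≡⟨ cong (_- ε (M ℕ.+ j)) (trans (cong ε (index M j)) ε-periodic) ⟩
    ε j - ε (M ℕ.+ j)                 ≡⟨ lemma (ε (M ℕ.+ j)) (ε j) ⟩
    - u j                             ∎
    where
    index : ∀ m j → m ℕ.+ (m ℕ.+ j) ≡ j ℕ.+ (m ℕ.+ (m ℕ.+ 0))
    index = ℕ-solve-∀
    lemma : ∀ (x y : ℤ) → y - x ≡ - (x - y)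
    lemma = solve-∀
    ε-periodic : ε (j ℕ.+ 2 ℕ.^ suc (suc a)) ≡ ε j
    ε-periodic = 2∣⇒-1^≡ (binSum ks (j ℕ.+ 2 ℕ.^ suc (suc a))) (binSum ks j) (binSum-even-period (suc (suc a)) ks bounded j)

  V : ℕ → ℤ
  V m = Δ^ M (S ks) m - S ks m

  V≡transform : ∀ m → V m ≡ binomialTransform u m
  V≡transform m = begin
    Δ^ M (S ks) m - S ks m                                          ≡⟨ cong₂ _-_ (Δ^-cong M m S≡transform) (S≡transform m) ⟩
    Δ^ M (binomialTransform ε) m - binomialTransform ε m            ≡⟨ cong (_- binomialTransform ε m) (Δ^-transform M ε m) ⟩
    binomialTransform (λ j → ε (M ℕ.+ j)) m - binomialTransform ε m ≡⟨ sym (transform-- (λ j → ε (M ℕ.+ j)) ε m) ⟩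
    binomialTransform u m                                           ∎

  G-annihilates : ∀ m → act G V m ≡ 0ℤ
  G-annihilates m = begin
    act G V m                                                       ≡⟨ act-Φ2^∘x-1 (suc a) V m ⟩
    V m + Δ^ M V m                                                  ≡⟨ cong₂ _+_ (V≡transform m) (trans (Δ^-cong M m V≡transform) (Δ^-transform M u m)) ⟩
    binomialTransform u m + binomialTransform (λ j → u (M ℕ.+ j)) m ≡⟨ sym (transform-+ u (λ j → u (M ℕ.+ j)) m) ⟩
    binomialTransform (λ j → u j + u (M ℕ.+ j)) m                   ≡⟨ transform-zero m (λ j → trans (cong (_+_ (u j)) (u-antiperiodic j)) (ℤP.+-inverseʳ (u j))) ⟩
    0ℤ                                                              ∎

  charPoly-annihilates-V : ∀ {as} → Satisfies (S ks) as → ∀ m → 1 ≤ m → act (charPoly as) V m ≡ 0ℤ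
  charPoly-annihilates-V {as} satisfies m 1≤m = begin
    act P V m                              ≡⟨ act-- P (Δ^ M (S ks)) (S ks) m ⟩
    act P (Δ^ M (S ks)) m - act P (S ks) m ≡⟨ cong₂ _-_ (act-Δ^ P M (S ks) m) (PS m 1≤m) ⟩
    Δ^ M (act P (S ks)) m - 0ℤ             ≡⟨ cong (_- 0ℤ) (Δ^-local M m (λ m′ m≤m′ _ → PS m′ (ℕP.≤-trans 1≤m m≤m′))) ⟩
    Δ^ M (λ _ → 0ℤ) m - 0ℤ                 ≡⟨ cong (_- 0ℤ) (Δ^-zero M m) ⟩
    0ℤ                                     ∎
    where
    P = charPoly as
    PS = charPoly-annihilates {S ks} {as} satisfies

  V∘suc≢0 : ¬ (∀ n → V (suc n) ≡ 0ℤ)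
  V∘suc≢0 V∘suc≡0 = proj₂ odd-jump (-1^≡⇒2∣ (binSum ks (j ℕ.+ M)) (binSum ks j) ε-unchanged)
    where
    odd-jump = binSum-odd-jump (suc a) ks sorted reaches
    j = proj₁ odd-jump
    u≡0 : ∀ i → u i ≡ 0ℤ
    u≡0 = transform-vanishing⇒antiperiodic≡0 (2 ℕ.^ a) u u-antiperiodic
      (λ n → trans (sym (V≡transform (suc n))) (V∘suc≡0 n))
    ε-unchanged : ε (j ℕ.+ M) ≡ ε j
    ε-unchanged = trans (cong ε (ℕP.+-comm j M)) (ℤP.i-j≡0⇒i≡j (ε (M ℕ.+ j)) (ε j) (u≡0 j))

  G-divides-charPoly : ∀ {as} → Satisfies (S ks) as → G ∣ₚ charPoly as
  G-divides-charPoly {as} satisfies =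
    eisenstein-divides prime[2] {G} {M} (Φ2^∘x-1-monic (suc a)) (Φ2^∘x-1-degree (suc a)) (Φ2^∘x-1-even (suc a))
      (subst (λ c → ¬ + 2 * + 2 ∣ c) (sym (Φ2^∘x-1-constant a)) ¬4∣2)
      {V ∘ suc} V∘suc≢0 (λ n → trans (act-shift G V n) (G-annihilates (suc n)))
      {charPoly as} (λ n → trans (act-shift (charPoly as) V n) (charPoly-annihilates-V {as} satisfies (suc n) (s≤s z≤n)))

-- Binary logarithms

2^⌊log₂⌋≤ : ∀ L n → ⌊log₂ n ⌋ ≡ L → 1 ≤ n → 2 ℕ.^ L ≤ n
2^⌊log₂⌋≤ zero    n             _      1≤n = 1≤n
2^⌊log₂⌋≤ (suc L) (suc zero)    ()     _
2^⌊log₂⌋≤ (suc L) n@(suc (suc m)) log≡1+L _ =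
  ℕP.≤-trans (ℕP.*-monoʳ-≤ 2 (2^⌊log₂⌋≤ L ⌊ n /2⌋ log-half (s≤s z≤n))) twice-half≤n
  where
  twice-half≤n : 2 ℕ.* ⌊ n /2⌋ ≤ n
  twice-half≤n = ℕP.≤-trans (ℕP.+-monoʳ-≤ ⌊ n /2⌋ (ℕP.≤-trans (ℕP.≤-reflexive (ℕP.+-identityʳ ⌊ n /2⌋)) (ℕP.⌊n/2⌋≤⌈n/2⌉ n)))
                            (ℕP.≤-reflexive (ℕP.⌊n/2⌋+⌈n/2⌉≡n n))
  log-half : ⌊log₂ ⌊ n /2⌋ ⌋ ≡ L
  log-half = trans (⌊log₂⌊n/2⌋⌋≡⌊log₂n⌋∸1 n) (cong (_∸ 1) log≡1+L)

<2^suc⌊log₂⌋ : ∀ n → n < 2 ℕ.^ suc ⌊log₂ n ⌋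
<2^suc⌊log₂⌋ n = ℕP.≰⇒> λ 2^[1+L]≤n → ℕP.<-irrefl refl
  (ℕP.≤-trans (ℕP.≤-reflexive (sym (⌊log₂[2^n]⌋≡n (suc ⌊log₂ n ⌋)))) (⌊log₂⌋-mono-≤ 2^[1+L]≤n))

mainTheorem5 : (ks : List ℕ) (kₛ : ℕ) →
    Linked _<_ (ks ++ [ kₛ ]) →
    All (1 ≤_) (ks ++ [ kₛ ]) →
    2 ≤ kₛ →
    (as : List ℤ) → MinimalRecurrence (S (ks ++ [ kₛ ])) as →
    (Φ2^ (rOf kₛ) ∘ₚ xMinus1) ∣ₚ charPoly as
mainTheorem5 ks kₛ sorted _ 2≤kₛ as (satisfies , _) =
  subst (λ r → (Φ2^ r ∘ₚ xMinus1) ∣ₚ charPoly as) (ℕP.+-comm 1 ⌊log₂ kₛ ⌋)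
    (at-exponent ⌊log₂ kₛ ⌋ (⌊log₂⌋-mono-≤ 2≤kₛ) (2^⌊log₂⌋≤ ⌊log₂ kₛ ⌋ kₛ refl (ℕP.≤-trans (s≤s z≤n) 2≤kₛ))
                 (<2^suc⌊log₂⌋ kₛ))
  where
  at-exponent : ∀ L → 1 ≤ L → 2 ℕ.^ L ≤ kₛ → kₛ < 2 ℕ.^ suc L → (Φ2^ (suc L) ∘ₚ xMinus1) ∣ₚ charPoly as
  at-exponent (suc a) _ M≤kₛ kₛ<2M = ExponentialSum.G-divides-charPoly (ks ++ [ kₛ ]) a sorted
    (All.map (λ k≤kₛ → ℕP.≤-<-trans k≤kₛ kₛ<2M) (sorted-bounded-by-last ks sorted))
    (++⁺ʳ ks (here M≤kₛ)) {as} satisfies
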